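{- Let $p>2$ be a prime, $r=(p-1)/2$, $\varepsilon=(-1)^{(p-1)/2}$ and $\zeta_p=e^{2\pi i/p}$. Let $Q$ be either $Q_1(x)=x^2/p$ or $Q_2(x)=cx^2/p$ (with $c$ a fixed quadratic non-residue modulo $p$), viewed as a function $\mathbb{Z}/p\mathbb{Z}\to\mathbb{Q}/\mathbb{Z}$. For $0\le j\le r$ put $\theta_j=e^{2\pi i Q(j)}$ (so $\theta_0=1$). Let $T$ be the $(r+1)\times(r+1)$ diagonal matrix $\operatorname{diag}(\theta_0,\theta_1,\dots,\theta_r)$ and let $V_Q$ be the $(r+1)\times(r+1)$ Vandermonde matrix with entries $(V_Q)_{jk}=\theta_j^{\,k}$, $0\le j,k\le r$ (it is invertible since the $\theta_j$ are pairwise distinct). Then every entry of the matrix $T'=V_Q^{ -1}TV_Q$ lies in $\mathbb{Z}[\tfrac{1}{2}(1+\sqrt{\varepsilon p})]$, the ring of integers of $\mathbb{Q}(\sqrt{\varepsilon p})$.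
   Context: Rows and columns of all matrices are indexed by $0,1,\dots,r$. -}

module Defs where

open import Data.Nat as ℕ using (ℕ; zero; suc; _∸_; NonZero)
open import Data.Nat.DivMod using (_mod_; _/_; _%_)
open import Data.Integer as ℤ using (ℤ; +_; -[1+_])
open import Data.Fin using (Fin; toℕ)
import Data.Fin as Fin
open import Relation.Binary.PropositionalEquality using (_≡_; _≢_)
open import Relation.Nullary using (¬_)
open import Data.Product using (∃)
open import Data.Bool using (if_then_else_)

-- The ring ℤ[ζ_p], modelled as the group ring ℤ[ℤ/pℤ] modulo the ideal
-- generated by the norm element 1 + x + ... + x^(p-1).
-- An element f : Fin p → ℤ stands for  Σ_i f(i) ζ_p^i .
-- For p prime, ℤ[x]/(x^p - 1, Φ_p) ≅ ℤ[ζ_p], and Φ_p(x) ≡ Σ x^i, so two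
-- group ring elements represent the same element of ℤ[ζ_p] iff their
-- difference is a constant multiple of the norm element, i.e. all
-- coefficients of the difference are equal.

Zζ : ℕ → Set
Zζ p = Fin p → ℤ

module _ {p : ℕ} .{{_ : NonZero p}} where

  infix 4 _≈ζ_ _≈M_
  infixl 6 _+ζ_ _-ζ_
  infixl 7 _*ζ_ _·ζ_ _⊗_
  infixr 8 _^ζ_

  _≈ζ_ : Zζ p → Zζ p → Set
  f ≈ζ g = ∀ i j → f i ℤ.- g i ≡ f j ℤ.- g j

  sumℤ : ∀ {n} → (Fin n → ℤ) → ℤ
  sumℤ {zero}  f = + 0
  sumℤ {suc n} f = f Fin.zero ℤ.+ sumℤ (λ i → f (Fin.suc i))

  0ζ : Zζ p
  0ζ _ = + 0

  fromℤζ : ℤ → Zζ p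
  fromℤζ n i = if toℕ i ℕ.≡ᵇ 0 then n else + 0

  1ζ : Zζ p
  1ζ = fromℤζ (+ 1)

  ζ^ : ℕ → Zζ p
  ζ^ k i = if toℕ i ℕ.≡ᵇ toℕ (k mod p) then + 1 else + 0

  _+ζ_ : Zζ p → Zζ p → Zζ p
  (f +ζ g) i = f i ℤ.+ g i

  _-ζ_ : Zζ p → Zζ p → Zζ p
  (f -ζ g) i = f i ℤ.- g i

  _*ζ_ : Zζ p → Zζ p → Zζ p
  (f *ζ g) i = sumℤ (λ j → f j ℤ.* g (((toℕ i ℕ.+ p) ∸ toℕ j) mod p))

  _·ζ_ : ℤ → Zζ p → Zζ p
  (n ·ζ f) i = n ℤ.* f i

  _^ζ_ : Zζ p → ℕ → Zζ p
  f ^ζ zero  = 1ζ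
  f ^ζ suc k = f *ζ (f ^ζ k)

  sumζ : ∀ {n} → (Fin n → Zζ p) → Zζ p
  sumζ {zero}  f = 0ζ
  sumζ {suc n} f = f Fin.zero +ζ sumζ (λ i → f (Fin.suc i))

  Mat : ℕ → Set
  Mat m = Fin m → Fin m → Zζ p

  _⊗_ : ∀ {m} → Mat m → Mat m → Mat m
  (A ⊗ B) j k = sumζ (λ l → A j l *ζ B l k)

  _≈M_ : ∀ {m} → Mat m → Mat m → Set
  A ≈M B = ∀ j k → A j k ≈ζ B j k

  rOf : ℕ
  rOf = (p ∸ 1) / 2

  εp : ℤ
  εp = (ℤ.- (+ 1)) ℤ.^ rOf ℤ.* + p

  -- θ_j = e^{2πi Q(j)} with Q(x) = c x² / p, i.e. θ_j = ζ_p^(c j²)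
  θ : ℕ → Fin (suc rOf) → Zζ p
  θ c j = ζ^ (c ℕ.* toℕ j ℕ.* toℕ j)

  Tmat : ℕ → Mat (suc rOf)
  Tmat c j k = if toℕ j ℕ.≡ᵇ toℕ k then θ c j else 0ζ

  Vmat : ℕ → Mat (suc rOf)
  Vmat c j k = θ c j ^ζ toℕ k

NonResidue : (p : ℕ) .{{_ : NonZero p}} → ℕ → Set
NonResidue p c = ∀ x → (x ℕ.* x) % p ≢ c % p

module Submission where

-- V T′ = T V says that T′ is the companion matrix of χ(x) = ∏ⱼ (x − θⱼ): its column k < r is the
-- unit vector e_{k+1}, and its last column holds the −χₗ, because θⱼ^(r+1) = Σₗ (−χₗ) θⱼ^l.
-- So it suffices that every coefficient χₗ lies in ℤ[ω], ω = Σ ζ^x over the squares x (0 included).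
-- The θⱼ with j ≠ 0 are the ζ^(c x²) for x in the half system 1, …, r, so the automorphisms
-- ζ ↦ ζ^(t²) permute them and fix each χₗ; an element of ℤ[ζ_p] fixed by all of them is constant on
-- the nonzero squares and on the nonsquares, hence lies in ℤ + ℤω. Finally 2ω − 1 is the Gauss sum
-- G = Σ_y ζ^(y²): G·Ḡ = p, Ḡ = ±G according as −1 is a square, and the sign is fixed modulo 4 by
-- G = 1 + 2(ω − 1).

open import Defs
open import Algebra.Bundles using (CommutativeRing; Semiring; AbelianGroup)
open import Algebra.Morphism.Structures using (IsRingHomomorphism)
import Algebra.Properties.CommutativeMonoid.Sum as MonoidSum
open import Data.Bool using (true; false; if_then_else_)
open import Data.Empty using (⊥-elim)
open import Data.Fin as Fin using (Fin; toℕ; fromℕ<)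
open import Data.Fin.Permutation using (Permutation; permutation; _⟨$⟩ʳ_)
open import Data.Fin.Properties using (any?; toℕ-injective; toℕ<n; toℕ-fromℕ<) renaming (_≟_ to _≟ᶠ_)
open import Data.Integer as ℤ using (ℤ; +_)
import Data.Integer.Properties as ℤ
import Data.Integer.Tactic.RingSolver as ℤ-Solver
open import Data.List as List using (List; _∷_; tabulate)
open import Data.List.Relation.Binary.Permutation.Propositional as ↭ using (_↭_)
open import Data.List.Relation.Binary.Permutation.Propositional.Properties using (++-commutativeMonoid)
open import Data.Maybe using (nothing)
open import Data.Nat as ℕ using (ℕ; zero; suc; NonZero; _<_; _≤_; _∸_; _≡ᵇ_; s≤s)
import Data.Nat.Properties as ℕ
open import Data.Nat.Coprimality using (coprime-Bézout; prime⇒coprime)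
open import Data.Nat.DivMod
  using (_mod_; %-distribˡ-+; %-distribˡ-*; m%n%n≡m%n; m*n%n≡0; m%n<n; m%n≤n; m<n⇒m%n≡m; m≡m%n+[m/n]*n; m*n/n≡m)
open import Data.Nat.Divisibility using (m%n≡0⇒n∣m)
open import Data.Nat.GCD using (module Bézout)
open import Data.Nat.Primality using (Prime; prime⇒irreducible)
import Data.Nat.Tactic.RingSolver as ℕ-Solver
open import Data.Product using (Σ; ∃; _×_; _,_; proj₁; proj₂)
open import Data.Sum using (_⊎_; inj₁; inj₂; [_,_]′)
open import Function using (_∘_)
open import Level using (0ℓ)
open import Relation.Binary.Bundles using (Setoid)
open import Relation.Binary.Structures using (IsEquivalence)
import Relation.Binary.Reasoning.Setoid as SetoidReasoning
open import Relation.Binary.PropositionalEquality as ≡ using (_≡_; _≢_; refl; sym; trans; cong; cong₂; subst; module ≡-Reasoning)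
open import Relation.Nullary using (¬_; Dec; yes; no; does; ¬?)
open import Relation.Nullary.Decidable using (map′)
open import Tactic.RingSolver.Core.AlmostCommutativeRing using (fromCommutativeRing)
import Tactic.RingSolver.NonReflective as NonReflective

infix 8 _²
_² : ∀ {n} → Fin n → ℕ
i ² = toℕ i ℕ.* toℕ i

module Mod (p : ℕ) .{{_ : NonZero p}} where
  open import Data.Nat using (_+_; _*_; _%_)
  open ℕ-Solver using (solve-∀)

  infix 4 _≡ₚ_ _≟ₚ_

  -- A record rather than a % p ≡ b % p itself, so that a and b can be inferred from a proof.
  record _≡ₚ_ (a b : ℕ) : Set where
    constructor mod-≡
    field %-≡ : a % p ≡ b % p
  open _≡ₚ_ public

  ≡ₚ-isEquivalence : IsEquivalence _≡ₚ_
  ≡ₚ-isEquivalence = record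
    { refl = mod-≡ refl
    ; sym = λ e → mod-≡ (sym (%-≡ e))
    ; trans = λ e f → mod-≡ (trans (%-≡ e) (%-≡ f))
    }

  ≡ₚ-setoid : Setoid 0ℓ 0ℓ
  ≡ₚ-setoid = record { isEquivalence = ≡ₚ-isEquivalence }

  open IsEquivalence ≡ₚ-isEquivalence public
    renaming (refl to ≡ₚ-refl; sym to ≡ₚ-sym; trans to ≡ₚ-trans)

  module ≡ₚ-Reasoning = SetoidReasoning ≡ₚ-setoid

  ≡⇒≡ₚ : ∀ {a b} → a ≡ b → a ≡ₚ b
  ≡⇒≡ₚ e = mod-≡ (cong (_% p) e)

  _≟ₚ_ : ∀ a b → Dec (a ≡ₚ b)
  a ≟ₚ b = map′ mod-≡ %-≡ (a % p ℕ.≟ b % p)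

  m%p≡ₚm : ∀ a → a % p ≡ₚ a
  m%p≡ₚm a = mod-≡ (m%n%n≡m%n a p)

  +-congₚ : ∀ {a a' b b'} → a ≡ₚ a' → b ≡ₚ b' → a + b ≡ₚ a' + b'
  +-congₚ {a} {a'} {b} {b'} (mod-≡ e) (mod-≡ f) = mod-≡ (begin
    (a + b) % p            ≡⟨ %-distribˡ-+ a b p ⟩
    (a % p + b % p) % p    ≡⟨ cong₂% e f ⟩
    (a' % p + b' % p) % p  ≡⟨ %-distribˡ-+ a' b' p ⟨
    (a' + b') % p          ∎)
    where
    open ≡-Reasoning
    cong₂% = cong₂ (λ x y → (x + y) % p)

  *-congₚ : ∀ {a a' b b'} → a ≡ₚ a' → b ≡ₚ b' → a * b ≡ₚ a' * b'
  *-congₚ {a} {a'} {b} {b'} (mod-≡ e) (mod-≡ f) = mod-≡ (begin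
    (a * b) % p              ≡⟨ %-distribˡ-* a b p ⟩
    (a % p * (b % p)) % p    ≡⟨ cong₂% e f ⟩
    (a' % p * (b' % p)) % p  ≡⟨ %-distribˡ-* a' b' p ⟨
    (a' * b') % p            ∎)
    where
    open ≡-Reasoning
    cong₂% = cong₂ (λ x y → (x * y) % p)

  +-congˡₚ : ∀ c {a b} → a ≡ₚ b → c + a ≡ₚ c + b
  +-congˡₚ c = +-congₚ (≡ₚ-refl {c})

  +-congʳₚ : ∀ c {a b} → a ≡ₚ b → a + c ≡ₚ b + c
  +-congʳₚ c e = +-congₚ e (≡ₚ-refl {c})

  *-congˡₚ : ∀ c {a b} → a ≡ₚ b → c * a ≡ₚ c * b
  *-congˡₚ c = *-congₚ (≡ₚ-refl {c})

  *-congʳₚ : ∀ c {a b} → a ≡ₚ b → a * c ≡ₚ b * c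
  *-congʳₚ c e = *-congₚ e (≡ₚ-refl {c})

  0%p≡0 : 0 % p ≡ 0
  0%p≡0 = m<n⇒m%n≡m (ℕ.>-nonZero⁻¹ p)

  n*p≡ₚ0 : ∀ n → n * p ≡ₚ 0
  n*p≡ₚ0 n = mod-≡ (trans (m*n%n≡0 n p) (sym 0%p≡0))

  p≡ₚ0 : p ≡ₚ 0
  p≡ₚ0 = ≡ₚ-trans (≡⇒≡ₚ (sym (ℕ.*-identityˡ p))) (n*p≡ₚ0 1)

  -ₚ_ : ℕ → ℕ
  -ₚ a = p ∸ a % p

  +-inverseʳₚ : ∀ a → a + -ₚ a ≡ₚ 0
  +-inverseʳₚ a = begin
    a + (p ∸ a % p)      ≈⟨ +-congʳₚ (p ∸ a % p) (m%p≡ₚm a) ⟨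
    a % p + (p ∸ a % p)  ≡⟨ ℕ.m+[n∸m]≡n (m%n≤n a p) ⟩
    p                    ≈⟨ p≡ₚ0 ⟩
    0                    ∎
    where open ≡ₚ-Reasoning

  +-inverseˡₚ : ∀ a → -ₚ a + a ≡ₚ 0
  +-inverseˡₚ a = ≡ₚ-trans (≡⇒≡ₚ (ℕ.+-comm (-ₚ a) a)) (+-inverseʳₚ a)

  +-cancelʳₚ : ∀ {a b} k → a + k ≡ₚ b + k → a ≡ₚ b
  +-cancelʳₚ {a} {b} k e = begin
    a               ≡⟨ ℕ.+-identityʳ a ⟨
    a + 0           ≈⟨ +-congˡₚ a (+-inverseʳₚ k) ⟨
    a + (k + -ₚ k)  ≡⟨ ℕ.+-assoc a k _ ⟨
    a + k + -ₚ k    ≈⟨ +-congʳₚ (-ₚ k) e ⟩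
    b + k + -ₚ k    ≡⟨ ℕ.+-assoc b k _ ⟩
    b + (k + -ₚ k)  ≈⟨ +-congˡₚ b (+-inverseʳₚ k) ⟩
    b + 0           ≡⟨ ℕ.+-identityʳ b ⟩
    b               ∎
    where open ≡ₚ-Reasoning

  [_] : ℕ → Fin p
  [ a ] = a mod p

  toℕ-[] : ∀ a → toℕ [ a ] ≡ₚ a
  toℕ-[] a = ≡ₚ-trans (≡⇒≡ₚ (toℕ-fromℕ< (m%n<n a p))) (m%p≡ₚm a)

  toℕ-injectiveₚ : ∀ {i j : Fin p} → toℕ i ≡ₚ toℕ j → i ≡ j
  toℕ-injectiveₚ {i} {j} (mod-≡ e) =
    toℕ-injective (trans (sym (m<n⇒m%n≡m (toℕ<n i))) (trans e (m<n⇒m%n≡m (toℕ<n j))))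

  []-cong : ∀ {a b} → a ≡ₚ b → [ a ] ≡ [ b ]
  []-cong e = toℕ-injectiveₚ (≡ₚ-trans (toℕ-[] _) (≡ₚ-trans e (≡ₚ-sym (toℕ-[] _))))

  []-injective : ∀ {a b} → [ a ] ≡ [ b ] → a ≡ₚ b
  []-injective {a} {b} e = ≡ₚ-trans (≡ₚ-sym (toℕ-[] a)) (≡ₚ-trans (≡⇒≡ₚ (cong toℕ e)) (toℕ-[] b))

  []-toℕ : ∀ i → [ toℕ i ] ≡ i
  []-toℕ i = toℕ-injectiveₚ (toℕ-[] (toℕ i))

  ≡[]⇒≡ₚ : ∀ {i a} → i ≡ [ a ] → toℕ i ≡ₚ a
  ≡[]⇒≡ₚ {a = a} e = ≡ₚ-trans (≡⇒≡ₚ (cong toℕ e)) (toℕ-[] a)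

  ≡ₚ⇒≡[] : ∀ {i a} → toℕ i ≡ₚ a → i ≡ [ a ]
  ≡ₚ⇒≡[] {i} e = trans (sym ([]-toℕ i)) ([]-cong e)

  toℕ-[0] : toℕ [ 0 ] ≡ 0
  toℕ-[0] = trans (toℕ-fromℕ< (m%n<n 0 p)) 0%p≡0

  infixl 6 _⊕_ _⊖_

  _⊕_ : Fin p → Fin p → Fin p
  i ⊕ j = [ toℕ i + toℕ j ]

  _⊖_ : Fin p → Fin p → Fin p
  i ⊖ j = [ (toℕ i + p) ∸ toℕ j ]

  ⊖-spec : ∀ i j → toℕ (i ⊖ j) + toℕ j ≡ₚ toℕ i
  ⊖-spec i j = begin
    toℕ (i ⊖ j) + toℕ j          ≈⟨ +-congʳₚ (toℕ j) (toℕ-[] _) ⟩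
    (toℕ i + p) ∸ toℕ j + toℕ j  ≡⟨ ℕ.m∸n+n≡m (ℕ.≤-trans (ℕ.<⇒≤ (toℕ<n j)) (ℕ.m≤n+m p (toℕ i))) ⟩
    toℕ i + p                    ≈⟨ +-congˡₚ (toℕ i) p≡ₚ0 ⟩
    toℕ i + 0                    ≡⟨ ℕ.+-identityʳ (toℕ i) ⟩
    toℕ i                        ∎
    where open ≡ₚ-Reasoning

  ⊖-unique : ∀ {i j x} → toℕ x + toℕ j ≡ₚ toℕ i → x ≡ i ⊖ j
  ⊖-unique {i} {j} e = toℕ-injectiveₚ (+-cancelʳₚ (toℕ j) (≡ₚ-trans e (≡ₚ-sym (⊖-spec i j))))

  ⊖-involutive : ∀ i j → i ⊖ (i ⊖ j) ≡ j
  ⊖-involutive i j = sym (⊖-unique (≡ₚ-trans (≡⇒≡ₚ (ℕ.+-comm (toℕ j) _)) (⊖-spec i j)))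

  ⊕-⊖ : ∀ l k → (l ⊕ k) ⊖ k ≡ l
  ⊕-⊖ l k = sym (⊖-unique {l ⊕ k} {k} (≡ₚ-sym (toℕ-[] _)))

  ⊖-⊕ : ∀ j k → (j ⊖ k) ⊕ k ≡ j
  ⊖-⊕ j k = toℕ-injectiveₚ (≡ₚ-trans (toℕ-[] _) (⊖-spec j k))

  ⊖-⊕-assoc : ∀ i k l → i ⊖ (l ⊕ k) ≡ (i ⊖ k) ⊖ l
  ⊖-⊕-assoc i k l = sym (⊖-unique (begin
    toℕ x + toℕ (l ⊕ k)      ≈⟨ +-congˡₚ (toℕ x) (toℕ-[] _) ⟩
    toℕ x + (toℕ l + toℕ k)  ≡⟨ ℕ.+-assoc (toℕ x) (toℕ l) (toℕ k) ⟨
    toℕ x + toℕ l + toℕ k    ≈⟨ +-congʳₚ (toℕ k) (⊖-spec (i ⊖ k) l) ⟩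
    toℕ (i ⊖ k) + toℕ k      ≈⟨ ⊖-spec i k ⟩
    toℕ i                    ∎))
    where
    x = (i ⊖ k) ⊖ l
    open ≡ₚ-Reasoning

  ⊖-identityʳ : ∀ i → i ⊖ [ 0 ] ≡ i
  ⊖-identityʳ i = sym (⊖-unique (≡⇒≡ₚ (trans (cong (_+_ (toℕ i)) toℕ-[0]) (ℕ.+-identityʳ (toℕ i)))))

  reflection : Fin p → Permutation p p
  reflection i = permutation (i ⊖_) (i ⊖_) (⊖-involutive i) (⊖-involutive i)

  translation : Fin p → Permutation p p
  translation k = permutation (_⊕ k) (_⊖ k) (λ j → ⊖-⊕ j k) (λ l → ⊕-⊖ l k)

  opposite-squares : ∀ y z → y + z ≡ₚ 0 → y * y ≡ₚ z * z
  opposite-squares y z y+z≡0 = +-cancelʳₚ (y * z) (begin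
    y * y + y * z  ≡⟨ ℕ.*-distribˡ-+ y y z ⟨
    y * (y + z)    ≈⟨ *-congˡₚ y y+z≡0 ⟩
    y * 0          ≡⟨ trans (ℕ.*-zeroʳ y) (sym (ℕ.*-zeroʳ z)) ⟩
    z * 0          ≈⟨ *-congˡₚ z y+z≡0 ⟨
    z * (y + z)    ≡⟨ expand z y ⟩
    z * z + y * z  ∎)
    where
    open ≡ₚ-Reasoning
    expand : ∀ z y → z * (y + z) ≡ z * z + y * z
    expand = solve-∀

  [p-1]+1≡ₚ0 : (p ∸ 1) + 1 ≡ₚ 0
  [p-1]+1≡ₚ0 = ≡ₚ-trans (≡⇒≡ₚ (ℕ.m∸n+n≡m (ℕ.>-nonZero⁻¹ p))) p≡ₚ0

  [p-1]²≡ₚ1 : (p ∸ 1) * (p ∸ 1) ≡ₚ 1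
  [p-1]²≡ₚ1 = opposite-squares (p ∸ 1) 1 [p-1]+1≡ₚ0

  [p-1]-swap : ∀ {a b} → a ≡ₚ (p ∸ 1) * b → (p ∸ 1) * a ≡ₚ b
  [p-1]-swap {a} {b} e = begin
    (p ∸ 1) * a              ≈⟨ *-congˡₚ (p ∸ 1) e ⟩
    (p ∸ 1) * ((p ∸ 1) * b)  ≡⟨ ℕ.*-assoc (p ∸ 1) (p ∸ 1) b ⟨
    (p ∸ 1) * (p ∸ 1) * b    ≈⟨ *-congʳₚ b [p-1]²≡ₚ1 ⟩
    1 * b                    ≡⟨ ℕ.*-identityˡ b ⟩
    b                        ∎
    where open ≡ₚ-Reasoning

module ModPrime (p : ℕ) .{{_ : NonZero p}} (prime : Prime p) where
  open import Data.Nat using (_+_; _*_; _%_)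
  open ℕ-Solver using (solve-∀)
  open Mod p

  inverseₚ : ∀ {a} → ¬ a ≡ₚ 0 → ∃ λ a' → a' * a ≡ₚ 1
  inverseₚ {a} a≢0 with coprime-Bézout (prime⇒coprime prime {{a%p≢0}} (m%n<n a p))
    where
    a%p≢0 : NonZero (a % p)
    a%p≢0 = ℕ.≢-nonZero λ e → a≢0 (mod-≡ (trans e (sym 0%p≡0)))
  ... | Bézout.-+ x y eq = y , (begin
    y * a        ≈⟨ *-congˡₚ y (m%p≡ₚm a) ⟨
    y * (a % p)  ≡⟨ eq ⟨
    1 + x * p    ≈⟨ +-congˡₚ 1 (n*p≡ₚ0 x) ⟩
    1 + 0        ∎)
    where open ≡ₚ-Reasoning
  ... | Bézout.+- x y eq = y * (p ∸ 1) , +-cancelʳₚ (p ∸ 1) (begin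
    y * (p ∸ 1) * a + (p ∸ 1)        ≈⟨ +-congʳₚ (p ∸ 1) (*-congˡₚ (y * (p ∸ 1)) (m%p≡ₚm a)) ⟨
    y * (p ∸ 1) * (a % p) + (p ∸ 1)  ≡⟨ factor y (p ∸ 1) (a % p) ⟩
    (1 + y * (a % p)) * (p ∸ 1)      ≡⟨ cong (_* (p ∸ 1)) eq ⟩
    x * p * (p ∸ 1)                  ≡⟨ x*p*q≡x*q*p x p (p ∸ 1) ⟩
    x * (p ∸ 1) * p                  ≈⟨ n*p≡ₚ0 (x * (p ∸ 1)) ⟩
    0                                ≈⟨ p≡ₚ0 ⟨
    p                                ≡⟨ ℕ.m+[n∸m]≡n (ℕ.>-nonZero⁻¹ p) ⟨
    1 + (p ∸ 1)                      ∎)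
    where
    open ≡ₚ-Reasoning
    x*p*q≡x*q*p : ∀ x p q → x * p * q ≡ x * q * p
    x*p*q≡x*q*p = solve-∀
    factor : ∀ y q b → y * q * b + q ≡ (1 + y * b) * q
    factor = solve-∀

  *-cancelˡₚ : ∀ {a b c} → ¬ a ≡ₚ 0 → a * b ≡ₚ a * c → b ≡ₚ c
  *-cancelˡₚ {a} {b} {c} a≢0 e with inverseₚ a≢0
  ... | a' , a'a≡1 = begin
    b             ≡⟨ ℕ.*-identityˡ b ⟨
    1 * b         ≈⟨ *-congʳₚ b a'a≡1 ⟨
    a' * a * b    ≡⟨ ℕ.*-assoc a' a b ⟩
    a' * (a * b)  ≈⟨ *-congˡₚ a' e ⟩
    a' * (a * c)  ≡⟨ ℕ.*-assoc a' a c ⟨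
    a' * a * c    ≈⟨ *-congʳₚ c a'a≡1 ⟩
    1 * c         ≡⟨ ℕ.*-identityˡ c ⟩
    c             ∎
    where open ≡ₚ-Reasoning

  euclidₚ : ∀ {a b} → a * b ≡ₚ 0 → a ≡ₚ 0 ⊎ b ≡ₚ 0
  euclidₚ {a} {b} e with a ≟ₚ 0
  ... | yes a≡0 = inj₁ a≡0
  ... | no a≢0 = inj₂ (*-cancelˡₚ a≢0 (≡ₚ-trans e (≡⇒≡ₚ (sym (ℕ.*-zeroʳ a)))))

  square≡0 : ∀ y → y * y ≡ₚ 0 → y ≡ₚ 0
  square≡0 y y²≡0 with euclidₚ y²≡0
  ... | inj₁ y≡0 = y≡0
  ... | inj₂ y≡0 = y≡0

  *-nonzeroₚ : ∀ {a b} → ¬ a ≡ₚ 0 → ¬ b ≡ₚ 0 → ¬ a * b ≡ₚ 0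
  *-nonzeroₚ a≢0 b≢0 e with euclidₚ e
  ... | inj₁ a≡0 = a≢0 a≡0
  ... | inj₂ b≡0 = b≢0 b≡0

  square-rootsₚ : ∀ {y z} → y * y ≡ₚ z * z → y ≡ₚ z ⊎ y + z ≡ₚ 0
  square-rootsₚ {y} {z} e with euclidₚ {y + z} {y + -ₚ z} product≡0
    where
    open ≡ₚ-Reasoning
    expand : ∀ y z w → (y + z) * (y + w) ≡ y * y + z * w + y * (z + w)
    expand = solve-∀
    factor : ∀ z w → z * z + z * w ≡ z * (z + w)
    factor = solve-∀
    product≡0 : (y + z) * (y + -ₚ z) ≡ₚ 0
    product≡0 = begin
      (y + z) * (y + -ₚ z)               ≡⟨ expand y z (-ₚ z) ⟩
      y * y + z * -ₚ z + y * (z + -ₚ z)  ≈⟨ +-congₚ (+-congʳₚ (z * -ₚ z) e) (*-congˡₚ y (+-inverseʳₚ z)) ⟩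
      z * z + z * -ₚ z + y * 0           ≡⟨ cong₂ _+_ (factor z (-ₚ z)) (ℕ.*-zeroʳ y) ⟩
      z * (z + -ₚ z) + 0                 ≈⟨ +-congʳₚ 0 (*-congˡₚ z (+-inverseʳₚ z)) ⟩
      z * 0 + 0                          ≡⟨ cong (_+ 0) (ℕ.*-zeroʳ z) ⟩
      0                                  ∎
  ... | inj₁ y+z≡0 = inj₂ y+z≡0
  ... | inj₂ y-z≡0 = inj₁ (+-cancelʳₚ (-ₚ z) (≡ₚ-trans y-z≡0 (≡ₚ-sym (+-inverseʳₚ z))))

  affine : ℕ → ℕ → Fin p → Fin p
  affine a b x = [ a * toℕ x + b ]

  affine-permutation : ∀ {a} → ¬ a ≡ₚ 0 → ℕ → Permutation p p
  affine-permutation {a} a≢0 b = permutation (affine a b) unaffine affine-unaffine unaffine-affine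
    where
    a' = proj₁ (inverseₚ a≢0)
    a'a≡1 = proj₂ (inverseₚ a≢0)
    unaffine : Fin p → Fin p
    unaffine y = [ a' * (toℕ y + -ₚ b) ]
    open ≡ₚ-Reasoning
    affine-unaffine : ∀ y → affine a b (unaffine y) ≡ y
    affine-unaffine y = toℕ-injectiveₚ (begin
      toℕ (affine a b (unaffine y))
        ≈⟨ toℕ-[] _ ⟩
      a * toℕ (unaffine y) + b
        ≈⟨ +-congʳₚ b (*-congˡₚ a (toℕ-[] _)) ⟩
      a * (a' * (toℕ y + -ₚ b)) + b
        ≡⟨ cong (_+ b) (ℕ.*-assoc a a' _) ⟨
      a * a' * (toℕ y + -ₚ b) + b
        ≈⟨ +-congʳₚ b (*-congʳₚ (toℕ y + -ₚ b) (≡ₚ-trans (≡⇒≡ₚ (ℕ.*-comm a a')) a'a≡1)) ⟩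
      1 * (toℕ y + -ₚ b) + b
        ≡⟨ rearrange (toℕ y) (-ₚ b) b ⟩
      toℕ y + (b + -ₚ b)
        ≈⟨ +-congˡₚ (toℕ y) (+-inverseʳₚ b) ⟩
      toℕ y + 0
        ≡⟨ ℕ.+-identityʳ (toℕ y) ⟩
      toℕ y ∎)
      where
      rearrange : ∀ y c b → 1 * (y + c) + b ≡ y + (b + c)
      rearrange = solve-∀
    unaffine-affine : ∀ x → unaffine (affine a b x) ≡ x
    unaffine-affine x = toℕ-injectiveₚ (begin
      toℕ (unaffine (affine a b x))     ≈⟨ toℕ-[] _ ⟩
      a' * (toℕ (affine a b x) + -ₚ b)  ≈⟨ *-congˡₚ a' (+-congʳₚ (-ₚ b) (toℕ-[] _)) ⟩
      a' * (a * toℕ x + b + -ₚ b)       ≡⟨ distribute a' a (toℕ x) b (-ₚ b) ⟩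
      a' * a * toℕ x + a' * (b + -ₚ b)  ≈⟨ +-congₚ (*-congʳₚ (toℕ x) a'a≡1) (*-congˡₚ a' (+-inverseʳₚ b)) ⟩
      1 * toℕ x + a' * 0                ≡⟨ simplify (toℕ x) a' ⟩
      toℕ x                             ∎)
      where
      distribute : ∀ a' a x b c → a' * (a * x + b + c) ≡ a' * a * x + a' * (b + c)
      distribute = solve-∀
      simplify : ∀ x a' → 1 * x + a' * 0 ≡ x
      simplify = solve-∀

module IntegerSums where
  open import Data.Integer using (_+_; _*_; _-_; -_)
  open ℤ-Solver using (solve-∀)

  open import Algebra.Properties.Semiring.Sum ℤ.+-*-semiring public
    using (sum; sum-cong-≗; ∑-distrib-+; ∑-comm; sum-permute; *-distribˡ-sum; *-distribʳ-sum)

  sum-const : ∀ {n} c → sum {n} (λ _ → c) ≡ + n * c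
  sum-const {zero} c = refl
  sum-const {suc n} c = trans (cong (_+_ c) (sum-const {n} c)) (sym (ℤ.suc-* (+ n) c))

  sum-neg : ∀ {n} (f : Fin n → ℤ) → sum (λ i → - f i) ≡ - sum f
  sum-neg {zero} f = refl
  sum-neg {suc n} f = trans (cong (_+_ (- f Fin.zero)) (sum-neg (f ∘ Fin.suc))) (sym (ℤ.neg-distrib-+ (f Fin.zero) _))

  ∑-distrib-minus : ∀ {n} (f g : Fin n → ℤ) → sum (λ i → f i - g i) ≡ sum f - sum g
  ∑-distrib-minus f g = trans (∑-distrib-+ f (λ i → - g i)) (cong (_+_ (sum f)) (sum-neg g))

  +-≤-≡ : ∀ {a b c d} → a ℤ.≤ b → c ℤ.≤ d → a + c ≡ b + d → a ≡ b
  +-≤-≡ {a} {b} {c} {d} a≤b c≤d e = ℤ.≤-antisym a≤b b≤a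
    where
    open ℤ.≤-Reasoning
    cancel : ∀ x y → x + y - y ≡ x
    cancel = solve-∀
    b≤a : b ℤ.≤ a
    b≤a = begin
      b          ≡⟨ cancel b d ⟨
      b + d - d  ≡⟨ cong (_- d) e ⟨
      a + c - d  ≤⟨ ℤ.+-monoˡ-≤ (- d) (ℤ.+-monoʳ-≤ a c≤d) ⟩
      a + d - d  ≡⟨ cancel a d ⟩
      a          ∎

  sum-mono-≤ : ∀ {n} {f g : Fin n → ℤ} → (∀ i → f i ℤ.≤ g i) → sum f ℤ.≤ sum g
  sum-mono-≤ {zero} _ = ℤ.≤-refl
  sum-mono-≤ {suc n} f≤g = ℤ.+-mono-≤ (f≤g Fin.zero) (sum-mono-≤ (f≤g ∘ Fin.suc))

  sum-≤-≡ : ∀ {n} {f g : Fin n → ℤ} → (∀ i → f i ℤ.≤ g i) → sum f ≡ sum g → ∀ i → f i ≡ g i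
  sum-≤-≡ {suc n} f≤g e Fin.zero = +-≤-≡ (f≤g Fin.zero) (sum-mono-≤ (f≤g ∘ Fin.suc)) e
  sum-≤-≡ {suc n} {f} {g} f≤g e (Fin.suc i) = sum-≤-≡ (f≤g ∘ Fin.suc) tail-sums-≡ i
    where
    cancel : ∀ x y → x + y - x ≡ y
    cancel = solve-∀
    tail-sums-≡ : sum (f ∘ Fin.suc) ≡ sum (g ∘ Fin.suc)
    tail-sums-≡ = begin
      sum (f ∘ Fin.suc)                            ≡⟨ cancel (f Fin.zero) _ ⟨
      f Fin.zero + sum (f ∘ Fin.suc) - f Fin.zero  ≡⟨ cong₂ _-_ e (sum-≤-≡ f≤g e Fin.zero) ⟩
      g Fin.zero + sum (g ∘ Fin.suc) - g Fin.zero  ≡⟨ cancel (g Fin.zero) _ ⟩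
      sum (g ∘ Fin.suc)                            ∎
      where open ≡-Reasoning

  if-≡ᵇ-≡ : ∀ {A : Set} {m n} {x y : A} → m ≡ n → (if m ≡ᵇ n then x else y) ≡ x
  if-≡ᵇ-≡ {m = m} {n} e with m ≡ᵇ n | ℕ.≡⇒≡ᵇ m n e
  ... | true | _ = refl

  if-≡ᵇ-≢ : ∀ {A : Set} {m n} {x y : A} → m ≢ n → (if m ≡ᵇ n then x else y) ≡ y
  if-≡ᵇ-≢ {m = m} {n} ne with m ≡ᵇ n | ℕ.≡ᵇ⇒≡ m n
  ... | true  | ≡ᵇ⇒≡ = ⊥-elim (ne (≡ᵇ⇒≡ _))
  ... | false | _    = refl

  δ : ∀ {n} → Fin n → Fin n → ℤ
  δ i j = if toℕ j ≡ᵇ toℕ i then + 1 else + 0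

  δ-≡ : ∀ {n} {i j : Fin n} → j ≡ i → δ i j ≡ + 1
  δ-≡ e = if-≡ᵇ-≡ (cong toℕ e)

  δ-≢ : ∀ {n} {i j : Fin n} → j ≢ i → δ i j ≡ + 0
  δ-≢ ne = if-≡ᵇ-≢ (ne ∘ toℕ-injective)


  δ-ext : ∀ {m n} {i j : Fin m} {k l : Fin n} → (j ≡ i → l ≡ k) → (l ≡ k → j ≡ i) → δ i j ≡ δ k l
  δ-ext {i = i} {j} to from with j ≟ᶠ i
  ... | yes j≡i = trans (δ-≡ j≡i) (sym (δ-≡ (to j≡i)))
  ... | no j≢i = trans (δ-≢ j≢i) (sym (δ-≢ (j≢i ∘ from)))

  δ-sym : ∀ {n} (i j : Fin n) → δ i j ≡ δ j i
  δ-sym i j = δ-ext {i = i} {j} {j} {i} sym sym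

  sum-δ : ∀ {n} (i : Fin n) (g : Fin n → ℤ) → sum (λ j → δ i j * g j) ≡ g i
  sum-δ {suc n} Fin.zero g = begin
    + 1 * g Fin.zero + sum (λ j → + 0 * g (Fin.suc j))
      ≡⟨ cong₂ _+_ (ℤ.*-identityˡ (g Fin.zero)) (sum-cong-≗ (λ j → ℤ.*-zeroˡ (g (Fin.suc j)))) ⟩
    g Fin.zero + sum {n} (λ _ → + 0)
      ≡⟨ cong (_+_ (g Fin.zero)) (trans (sum-const {n} (+ 0)) (ℤ.*-zeroʳ (+ n))) ⟩
    g Fin.zero + + 0
      ≡⟨ ℤ.+-identityʳ _ ⟩
    g Fin.zero ∎
    where open ≡-Reasoning
  sum-δ {suc n} (Fin.suc i) g =
    trans (cong (_+ sum (λ j → δ i j * g (Fin.suc j))) (ℤ.*-zeroˡ (g Fin.zero)))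
      (trans (ℤ.+-identityˡ _) (sum-δ i (g ∘ Fin.suc)))

  sum-δ≡1 : ∀ {n} (i : Fin n) → sum (δ i) ≡ + 1
  sum-δ≡1 i = trans (sum-cong-≗ {x = δ i} (λ j → sym (ℤ.*-identityʳ (δ i j)))) (sum-δ i (λ _ → + 1))

module GroupRing (p : ℕ) .{{_ : NonZero p}} where
  open import Data.Integer using (_+_; _*_; _-_; -_)
  open ℤ-Solver using (solve-∀)
  open Mod p
  open IntegerSums

  R : Set
  R = Zζ p

  infix 4 _≐_
  _≐_ : R → R → Set
  f ≐ g = ∀ i → f i ≡ g i

  sumℤ≡sum : ∀ {n} (f : Fin n → ℤ) → sumℤ {p} f ≡ sum f
  sumℤ≡sum {zero} f = refl
  sumℤ≡sum {suc n} f = cong (_+_ (f Fin.zero)) (sumℤ≡sum (f ∘ Fin.suc))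

  sumζ-apply : ∀ {n} (F : Fin n → R) i → sumζ F i ≡ sum (λ j → F j i)
  sumζ-apply {zero} F i = refl
  sumζ-apply {suc n} F i = cong (_+_ (F Fin.zero i)) (sumζ-apply (F ∘ Fin.suc) i)

  *ζ-apply : ∀ (f g : R) i → (f *ζ g) i ≡ sum (λ j → f j * g (i ⊖ j))
  *ζ-apply f g i = sumℤ≡sum (λ j → f j * g (i ⊖ j))

  1ζ≐δ0 : 1ζ ≐ δ [ 0 ]
  1ζ≐δ0 i = cong (λ k → if toℕ i ≡ᵇ k then + 1 else + 0) (sym toℕ-[0])

  -ζ_ : R → R
  (-ζ f) i = - f i

  open ≡-Reasoning

  *ζ-comm : ∀ f g → f *ζ g ≐ g *ζ f
  *ζ-comm f g i = begin
    (f *ζ g) i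
      ≡⟨ *ζ-apply f g i ⟩
    sum (λ j → f j * g (i ⊖ j))
      ≡⟨ sum-permute (λ j → f j * g (i ⊖ j)) (reflection i) ⟩
    sum (λ j → f (i ⊖ j) * g (i ⊖ (i ⊖ j)))
      ≡⟨ sum-cong-≗ (λ j → trans (cong (λ k → f (i ⊖ j) * g k) (⊖-involutive i j)) (ℤ.*-comm (f (i ⊖ j)) (g j))) ⟩
    sum (λ j → g j * f (i ⊖ j))
      ≡⟨ *ζ-apply g f i ⟨
    (g *ζ f) i ∎

  *ζ-assoc : ∀ f g h → (f *ζ g) *ζ h ≐ f *ζ (g *ζ h)
  *ζ-assoc f g h i = begin
    ((f *ζ g) *ζ h) i
      ≡⟨ *ζ-apply (f *ζ g) h i ⟩
    sum (λ j → (f *ζ g) j * h (i ⊖ j))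
      ≡⟨ sum-cong-≗ expand ⟩
    sum (λ j → sum (λ k → f k * g (j ⊖ k) * h (i ⊖ j)))
      ≡⟨ ∑-comm (λ j k → f k * g (j ⊖ k) * h (i ⊖ j)) ⟩
    sum (λ k → sum (λ j → f k * g (j ⊖ k) * h (i ⊖ j)))
      ≡⟨ sum-cong-≗ factor ⟩
    sum (λ k → f k * sum (λ j → g (j ⊖ k) * h (i ⊖ j)))
      ≡⟨ sum-cong-≗ (λ k → cong (f k *_) (reindex k)) ⟩
    sum (λ k → f k * (g *ζ h) (i ⊖ k))
      ≡⟨ *ζ-apply f (g *ζ h) i ⟨
    (f *ζ (g *ζ h)) i ∎
    where
    expand : ∀ j → (f *ζ g) j * h (i ⊖ j) ≡ sum (λ k → f k * g (j ⊖ k) * h (i ⊖ j))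
    expand j = trans (cong (_* h (i ⊖ j)) (*ζ-apply f g j)) (*-distribʳ-sum (h (i ⊖ j)) (λ k → f k * g (j ⊖ k)))
    factor : ∀ k → sum (λ j → f k * g (j ⊖ k) * h (i ⊖ j)) ≡ f k * sum (λ j → g (j ⊖ k) * h (i ⊖ j))
    factor k = trans (sum-cong-≗ (λ j → ℤ.*-assoc (f k) (g (j ⊖ k)) (h (i ⊖ j))))
                     (sym (*-distribˡ-sum (f k) (λ j → g (j ⊖ k) * h (i ⊖ j))))
    reindex : ∀ k → sum (λ j → g (j ⊖ k) * h (i ⊖ j)) ≡ (g *ζ h) (i ⊖ k)
    reindex k = begin
      sum (λ j → g (j ⊖ k) * h (i ⊖ j))
        ≡⟨ sum-permute (λ j → g (j ⊖ k) * h (i ⊖ j)) (translation k) ⟩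
      sum (λ l → g ((l ⊕ k) ⊖ k) * h (i ⊖ (l ⊕ k)))
        ≡⟨ sum-cong-≗ (λ l → cong₂ (λ a b → g a * h b) (⊕-⊖ l k) (⊖-⊕-assoc i k l)) ⟩
      sum (λ l → g l * h ((i ⊖ k) ⊖ l))
        ≡⟨ *ζ-apply g h (i ⊖ k) ⟨
      (g *ζ h) (i ⊖ k) ∎

  *ζ-identityˡ : ∀ f → 1ζ *ζ f ≐ f
  *ζ-identityˡ f i = begin
    (1ζ *ζ f) i                        ≡⟨ *ζ-apply 1ζ f i ⟩
    sum (λ j → 1ζ j * f (i ⊖ j))       ≡⟨ sum-cong-≗ (λ j → cong (_* f (i ⊖ j)) (1ζ≐δ0 j)) ⟩
    sum (λ j → δ [ 0 ] j * f (i ⊖ j))  ≡⟨ sum-δ [ 0 ] _ ⟩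
    f (i ⊖ [ 0 ])                      ≡⟨ cong f (⊖-identityʳ i) ⟩
    f i                                ∎

  *ζ-distribˡ : ∀ f g h → f *ζ (g +ζ h) ≐ (f *ζ g) +ζ (f *ζ h)
  *ζ-distribˡ f g h i = begin
    (f *ζ (g +ζ h)) i
      ≡⟨ *ζ-apply f (g +ζ h) i ⟩
    sum (λ j → f j * (g (i ⊖ j) + h (i ⊖ j)))
      ≡⟨ sum-cong-≗ (λ j → ℤ.*-distribˡ-+ (f j) (g (i ⊖ j)) (h (i ⊖ j))) ⟩
    sum (λ j → f j * g (i ⊖ j) + f j * h (i ⊖ j))
      ≡⟨ ∑-distrib-+ (λ j → f j * g (i ⊖ j)) (λ j → f j * h (i ⊖ j)) ⟩
    sum (λ j → f j * g (i ⊖ j)) + sum (λ j → f j * h (i ⊖ j))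
      ≡⟨ cong₂ _+_ (*ζ-apply f g i) (*ζ-apply f h i) ⟨
    (f *ζ g) i + (f *ζ h) i ∎

  *ζ-identityʳ : ∀ f → f *ζ 1ζ ≐ f
  *ζ-identityʳ f i = trans (*ζ-comm f 1ζ i) (*ζ-identityˡ f i)

  *ζ-distribʳ : ∀ f g h → (g +ζ h) *ζ f ≐ (g *ζ f) +ζ (h *ζ f)
  *ζ-distribʳ f g h i =
    trans (*ζ-comm (g +ζ h) f i) (trans (*ζ-distribˡ f g h i) (cong₂ _+_ (*ζ-comm f g i) (*ζ-comm f h i)))

  *ζ-cong : ∀ {f f' g g'} → f ≐ f' → g ≐ g' → f *ζ g ≐ f' *ζ g'
  *ζ-cong {f} {f'} {g} {g'} e e' i = begin
    (f *ζ g) i                     ≡⟨ *ζ-apply f g i ⟩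
    sum (λ j → f j * g (i ⊖ j))    ≡⟨ sum-cong-≗ (λ j → cong₂ _*_ (e j) (e' (i ⊖ j))) ⟩
    sum (λ j → f' j * g' (i ⊖ j))  ≡⟨ *ζ-apply f' g' i ⟨
    (f' *ζ g') i                   ∎

  *ζ-congˡ : ∀ f {g g'} → g ≐ g' → f *ζ g ≐ f *ζ g'
  *ζ-congˡ f = *ζ-cong {f} {f} (λ _ → refl)

  ℤ[Cₚ] : CommutativeRing 0ℓ 0ℓ
  ℤ[Cₚ] = record
    { Carrier = R ; _≈_ = _≐_ ; _+_ = _+ζ_ ; _*_ = _*ζ_ ; -_ = -ζ_ ; 0# = 0ζ ; 1# = 1ζ
    ; isCommutativeRing = record
      { isRing = record
        { +-isAbelianGroup = record
          { isGroup = record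
            { isMonoid = record
              { isSemigroup = record
                { isMagma = record
                  { isEquivalence = record { refl = λ _ → refl ; sym = λ e i → sym (e i) ; trans = λ e e' i → trans (e i) (e' i) }
                  ; ∙-cong = λ e e' i → cong₂ _+_ (e i) (e' i) }
                ; assoc = λ f g h i → ℤ.+-assoc (f i) (g i) (h i) }
              ; identity = (λ f i → ℤ.+-identityˡ (f i)) , (λ f i → ℤ.+-identityʳ (f i)) }
            ; inverse = (λ f i → ℤ.+-inverseˡ (f i)) , (λ f i → ℤ.+-inverseʳ (f i))
            ; ⁻¹-cong = λ e i → cong -_ (e i) }
          ; comm = λ f g i → ℤ.+-comm (f i) (g i) }
        ; *-cong = *ζ-cong
        ; *-assoc = *ζ-assoc
        ; *-identity = *ζ-identityˡ , *ζ-identityʳ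
        ; distrib = *ζ-distribˡ , *ζ-distribʳ }
      ; *-comm = *ζ-comm } }

  private
    module C = CommutativeRing ℤ[Cₚ]

  ζ^-cong : ∀ {a b} → a ≡ₚ b → ζ^ a ≐ ζ^ b
  ζ^-cong e i = cong (λ k → δ k i) ([]-cong e)

  ζ^-+ : ∀ a b → ζ^ a *ζ ζ^ b ≐ ζ^ (a ℕ.+ b)
  ζ^-+ a b i = begin
    (ζ^ a *ζ ζ^ b) i                         ≡⟨ *ζ-apply (ζ^ a) (ζ^ b) i ⟩
    sum (λ j → δ [ a ] j * δ [ b ] (i ⊖ j))  ≡⟨ sum-δ [ a ] (λ j → δ [ b ] (i ⊖ j)) ⟩
    δ [ b ] (i ⊖ [ a ])                      ≡⟨ δ-ext to from ⟩
    δ [ a ℕ.+ b ] i                          ∎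
    where
    key : toℕ [ b ] ℕ.+ toℕ [ a ] ≡ₚ toℕ [ a ℕ.+ b ]
    key = ≡ₚ-trans (+-congₚ (toℕ-[] b) (toℕ-[] a)) (≡ₚ-trans (≡⇒≡ₚ (ℕ.+-comm b a)) (≡ₚ-sym (toℕ-[] (a ℕ.+ b))))
    to : i ⊖ [ a ] ≡ [ b ] → i ≡ [ a ℕ.+ b ]
    to e = toℕ-injectiveₚ (≡ₚ-trans (≡ₚ-sym (⊖-spec i [ a ]))
                                    (≡ₚ-trans (≡⇒≡ₚ (cong (λ x → toℕ x ℕ.+ toℕ [ a ]) e)) key))
    from : i ≡ [ a ℕ.+ b ] → i ⊖ [ a ] ≡ [ b ]
    from e = sym (⊖-unique (≡ₚ-trans key (≡⇒≡ₚ (cong toℕ (sym e)))))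

  sumζ-*ζʳ : ∀ {n} (F : Fin n → R) g → sumζ F *ζ g ≐ sumζ (λ y → F y *ζ g)
  sumζ-*ζʳ {zero} F g = C.zeroˡ g
  sumζ-*ζʳ {suc n} F g i =
    trans (C.distribʳ g (F Fin.zero) (sumζ (F ∘ Fin.suc)) i) (cong (_+_ ((F Fin.zero *ζ g) i)) (sumζ-*ζʳ (F ∘ Fin.suc) g i))

  sumζ-cong : ∀ {n} {F G : Fin n → R} → (∀ j → F j ≐ G j) → sumζ F ≐ sumζ G
  sumζ-cong {zero} e _ = refl
  sumζ-cong {suc n} e i = cong₂ _+_ (e Fin.zero i) (sumζ-cong (e ∘ Fin.suc) i)

  *ζ-sumζ : ∀ {n} f (G : Fin n → R) → f *ζ sumζ G ≐ sumζ (λ z → f *ζ G z)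
  *ζ-sumζ f G i = trans (*ζ-comm f (sumζ G) i) (trans (sumζ-*ζʳ G f i) (sumζ-cong (λ z → *ζ-comm (G z) f) i))

  sumζ-*ζ-sumζ : ∀ {m n} (F : Fin m → R) (G : Fin n → R) →
                 sumζ F *ζ sumζ G ≐ sumζ (λ y → sumζ (λ z → F y *ζ G z))
  sumζ-*ζ-sumζ F G i = trans (sumζ-*ζʳ F (sumζ G) i) (sumζ-cong (λ y → *ζ-sumζ (F y) G) i)

  fromℤζ-apply : ∀ n i → fromℤζ n i ≡ n * δ [ 0 ] i
  fromℤζ-apply n i with toℕ i ≡ᵇ 0 | 1ζ≐δ0 i
  ... | true  | 1≡δ0 = trans (sym (ℤ.*-identityʳ n)) (cong (n *_) 1≡δ0)
  ... | false | 0≡δ0 = trans (sym (ℤ.*-zeroʳ n)) (cong (n *_) 0≡δ0)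

  fromℤζ-*ζ : ∀ n f → fromℤζ n *ζ f ≐ n ·ζ f
  fromℤζ-*ζ n f i = begin
    (fromℤζ n *ζ f) i
      ≡⟨ *ζ-apply (fromℤζ n) f i ⟩
    sum (λ j → fromℤζ n j * f (i ⊖ j))
      ≡⟨ sum-cong-≗ (λ j → trans (cong (_* f (i ⊖ j)) (fromℤζ-apply n j)) (ℤ.*-assoc n (δ [ 0 ] j) (f (i ⊖ j)))) ⟩
    sum (λ j → n * (δ [ 0 ] j * f (i ⊖ j)))
      ≡⟨ *-distribˡ-sum n (λ j → δ [ 0 ] j * f (i ⊖ j)) ⟨
    n * sum (λ j → δ [ 0 ] j * f (i ⊖ j))
      ≡⟨ cong (n *_) (trans (sum-δ [ 0 ] (λ j → f (i ⊖ j))) (cong f (⊖-identityʳ i))) ⟩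
    n * f i ∎

  diagonal-⊗ : ∀ {m} (d : Fin m → R) (M : Mat m) j k →
               ((λ j l → if toℕ j ≡ᵇ toℕ l then d j else 0ζ) ⊗ M) j k ≐ d j *ζ M j k
  diagonal-⊗ d M j k i = begin
    sumζ (λ l → D l *ζ M l k) i           ≡⟨ sumζ-apply (λ l → D l *ζ M l k) i ⟩
    sum (λ l → (D l *ζ M l k) i)          ≡⟨ sum-cong-≗ term ⟩
    sum (λ l → δ j l * (d j *ζ M l k) i)  ≡⟨ sum-δ j (λ l → (d j *ζ M l k) i) ⟩
    (d j *ζ M j k) i                      ∎
    where
    D : Fin _ → R
    D l = if toℕ j ≡ᵇ toℕ l then d j else 0ζ
    term : ∀ l → (D l *ζ M l k) i ≡ δ j l * (d j *ζ M l k) i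
    term l with l ≟ᶠ j
    ... | yes refl = begin
      (D l *ζ M l k) i          ≡⟨ cong (λ f → (f *ζ M l k) i) (if-≡ᵇ-≡ {m = toℕ l} {toℕ l} {d l} {0ζ} refl) ⟩
      (d l *ζ M l k) i          ≡⟨ ℤ.*-identityˡ ((d l *ζ M l k) i) ⟨
      + 1 * (d l *ζ M l k) i    ≡⟨ cong (_* (d l *ζ M l k) i) (δ-≡ {i = l} refl) ⟨
      δ l l * (d l *ζ M l k) i  ∎
    ... | no l≢j = begin
      (D l *ζ M l k) i
        ≡⟨ cong (λ f → (f *ζ M l k) i) (if-≡ᵇ-≢ {m = toℕ j} {toℕ l} {d j} {0ζ} (l≢j ∘ sym ∘ toℕ-injective)) ⟩
      (0ζ *ζ M l k) i
        ≡⟨ C.zeroˡ (M l k) i ⟩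
      + 0
        ≡⟨ ℤ.*-zeroˡ ((d j *ζ M l k) i) ⟨
      + 0 * (d j *ζ M l k) i
        ≡⟨ cong (_* (d j *ζ M l k) i) (δ-≢ l≢j) ⟨
      δ j l * (d j *ζ M l k) i ∎

module CyclotomicIntegers (p : ℕ) .{{_ : NonZero p}} where
  open import Data.Integer using (_+_; _*_; _-_; -_)
  open ℤ-Solver using (solve-∀)
  open Mod p
  open IntegerSums
  open GroupRing p
  open ≡-Reasoning

  private
    module C = CommutativeRing ℤ[Cₚ]

  ≐⇒≈ζ : ∀ {f g} → f ≐ g → f ≈ζ g
  ≐⇒≈ζ {f} {g} e i j = trans (i-j≡0 i) (sym (i-j≡0 j))
    where
    i-j≡0 : ∀ i → f i - g i ≡ + 0
    i-j≡0 i = ℤ.i≡j⇒i-j≡0 (e i)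

  ≈ζ-sym : ∀ {f g} → f ≈ζ g → g ≈ζ f
  ≈ζ-sym {f} {g} e i j = begin
    g i - f i      ≡⟨ swap (f i) (g i) ⟩
    - (f i - g i)  ≡⟨ cong -_ (e i j) ⟩
    - (f j - g j)  ≡⟨ swap (f j) (g j) ⟨
    g j - f j      ∎
    where
    swap : ∀ a b → b - a ≡ - (a - b)
    swap = solve-∀

  ≈ζ-trans : ∀ {f g h} → f ≈ζ g → g ≈ζ h → f ≈ζ h
  ≈ζ-trans {f} {g} {h} e e' i j = begin
    f i - h i                  ≡⟨ ℤ.+-minus-telescope (f i) (g i) (h i) ⟨
    (f i - g i) + (g i - h i)  ≡⟨ cong₂ _+_ (e i j) (e' i j) ⟩
    (f j - g j) + (g j - h j)  ≡⟨ ℤ.+-minus-telescope (f j) (g j) (h j) ⟩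
    f j - h j                  ∎

  ≈ζ-isEquivalence : IsEquivalence _≈ζ_
  ≈ζ-isEquivalence = record
    { refl = λ {f} → ≐⇒≈ζ {f} (λ _ → refl)
    ; sym = λ {f} {g} → ≈ζ-sym {f} {g}
    ; trans = λ {f} {g} {h} → ≈ζ-trans {f} {g} {h}
    }

  +ζ-cong≈ : ∀ {f f' g g'} → f ≈ζ f' → g ≈ζ g' → f +ζ g ≈ζ f' +ζ g'
  +ζ-cong≈ {f} {f'} {g} {g'} e e' i j = begin
    (f i + g i) - (f' i + g' i)  ≡⟨ interchange (f i) (g i) (f' i) (g' i) ⟩
    (f i - f' i) + (g i - g' i)  ≡⟨ cong₂ _+_ (e i j) (e' i j) ⟩
    (f j - f' j) + (g j - g' j)  ≡⟨ interchange (f j) (g j) (f' j) (g' j) ⟨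
    (f j + g j) - (f' j + g' j)  ∎
    where
    interchange : ∀ a b c d → (a + b) - (c + d) ≡ (a - c) + (b - d)
    interchange = solve-∀

  -ζ-cong≈ : ∀ {f g} → f ≈ζ g → -ζ f ≈ζ -ζ g
  -ζ-cong≈ {f} {g} e i j = begin
    - f i - - g i  ≡⟨ negate (f i) (g i) ⟩
    - (f i - g i)  ≡⟨ cong -_ (e i j) ⟩
    - (f j - g j)  ≡⟨ negate (f j) (g j) ⟨
    - f j - - g j  ∎
    where
    negate : ∀ a b → - a - - b ≡ - (a - b)
    negate = solve-∀

  *ζ-congʳ≈ : ∀ {f f'} g → f ≈ζ f' → f *ζ g ≈ζ f' *ζ g
  *ζ-congʳ≈ {f} {f'} g e i j = trans (difference i) (sym (difference j))
    where
    c = f [ 0 ] - f' [ 0 ]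
    difference : ∀ i → (f *ζ g) i - (f' *ζ g) i ≡ c * sum g
    difference i = begin
      (f *ζ g) i - (f' *ζ g) i
        ≡⟨ cong₂ _-_ (*ζ-apply f g i) (*ζ-apply f' g i) ⟩
      sum (λ j → f j * g (i ⊖ j)) - sum (λ j → f' j * g (i ⊖ j))
        ≡⟨ ∑-distrib-minus (λ j → f j * g (i ⊖ j)) (λ j → f' j * g (i ⊖ j)) ⟨
      sum (λ j → f j * g (i ⊖ j) - f' j * g (i ⊖ j))
        ≡⟨ sum-cong-≗ (λ j → trans (factor (f j) (f' j) (g (i ⊖ j))) (cong (_* g (i ⊖ j)) (e j [ 0 ]))) ⟩
      sum (λ j → c * g (i ⊖ j))
        ≡⟨ *-distribˡ-sum c (λ j → g (i ⊖ j)) ⟨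
      c * sum (λ j → g (i ⊖ j))
        ≡⟨ cong (c *_) (sum-permute g (reflection i)) ⟨
      c * sum g ∎
      where
      factor : ∀ a b x → a * x - b * x ≡ (a - b) * x
      factor = solve-∀

  *ζ-cong≈ : ∀ {f f' g g'} → f ≈ζ f' → g ≈ζ g' → f *ζ g ≈ζ f' *ζ g'
  *ζ-cong≈ {f} {f'} {g} {g'} e e' =
    ≈ζ-trans {f *ζ g} {f' *ζ g} (*ζ-congʳ≈ {f} {f'} g e)
      (≈ζ-trans {f' *ζ g} {g *ζ f'} (≐⇒≈ζ (*ζ-comm f' g))
        (≈ζ-trans {g *ζ f'} {g' *ζ f'} (*ζ-congʳ≈ {g} {g'} f' e') (≐⇒≈ζ (*ζ-comm g' f'))))

  ℤ[ζ] : CommutativeRing 0ℓ 0ℓ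
  ℤ[ζ] = record
    { Carrier = R ; _≈_ = _≈ζ_ ; _+_ = _+ζ_ ; _*_ = _*ζ_ ; -_ = -ζ_ ; 0# = 0ζ ; 1# = 1ζ
    ; isCommutativeRing = record
      { isRing = record
        { +-isAbelianGroup = record
          { isGroup = record
            { isMonoid = record
              { isSemigroup = record
                { isMagma = record { isEquivalence = ≈ζ-isEquivalence ; ∙-cong = λ {f} {f'} {g} {g'} → +ζ-cong≈ {f} {f'} {g} {g'} }
                ; assoc = λ f g h → ≐⇒≈ζ (C.+-assoc f g h) }
              ; identity = (λ f → ≐⇒≈ζ (C.+-identityˡ f)) , (λ f → ≐⇒≈ζ (C.+-identityʳ f)) }
            ; inverse = (λ f → ≐⇒≈ζ (C.-‿inverseˡ f)) , (λ f → ≐⇒≈ζ (C.-‿inverseʳ f))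
            ; ⁻¹-cong = λ {f} {g} → -ζ-cong≈ {f} {g} }
          ; comm = λ f g → ≐⇒≈ζ (C.+-comm f g) }
        ; *-cong = λ {f} {f'} {g} {g'} → *ζ-cong≈ {f} {f'} {g} {g'}
        ; *-assoc = λ f g h → ≐⇒≈ζ (C.*-assoc f g h)
        ; *-identity = (λ f → ≐⇒≈ζ (C.*-identityˡ f)) , (λ f → ≐⇒≈ζ (C.*-identityʳ f))
        ; distrib = (λ f g h → ≐⇒≈ζ (C.distribˡ f g h)) , (λ f g h → ≐⇒≈ζ (C.distribʳ f g h)) }
      ; *-comm = λ f g → ≐⇒≈ζ (C.*-comm f g) } }

  sumζ-cong≈ : ∀ {n} {F G : Fin n → R} → (∀ j → F j ≈ζ G j) → sumζ F ≈ζ sumζ G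
  sumζ-cong≈ {zero} F≈G = ≐⇒≈ζ {0ζ} (λ _ → refl)
  sumζ-cong≈ {suc n} {F} {G} F≈G = +ζ-cong≈ {F Fin.zero} {G Fin.zero} (F≈G Fin.zero) (sumζ-cong≈ (F≈G ∘ Fin.suc))

module QuadraticResidues (p : ℕ) .{{_ : NonZero p}} (prime : Prime p) (2<p : 2 ℕ.< p) where
  open import Data.Integer using (_+_; _*_; _-_)
  open ℕ-Solver using (solve-∀)
  open Mod p
  open ModPrime p prime
  open IntegerSums

  1≢ₚ0 : ¬ 1 ≡ₚ 0
  1≢ₚ0 (mod-≡ e) with trans (sym (m<n⇒m%n≡m (ℕ.<-trans (ℕ.n<1+n 1) 2<p))) (trans e 0%p≡0)
  ... | ()

  2≢ₚ0 : ¬ 2 ≡ₚ 0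
  2≢ₚ0 (mod-≡ e) with trans (sym (m<n⇒m%n≡m 2<p)) (trans e 0%p≡0)
  ... | ()

  p≡2r+1 : p ≡ suc (rOf {p} ℕ.+ rOf {p})
  p≡2r+1 = begin
    p                          ≡⟨ p≡1+2h ⟩
    suc (h ℕ.* 2)              ≡⟨ cong suc (double h) ⟩
    suc (h ℕ.+ h)              ≡⟨ cong (λ n → suc (n ℕ.+ n)) r≡h ⟨
    suc (rOf {p} ℕ.+ rOf {p})  ∎
    where
    open ≡-Reasoning
    double : ∀ h → h ℕ.* 2 ≡ h ℕ.+ h
    double = solve-∀
    h = p ℕ./ 2
    p%2≡1 : p ℕ.% 2 ≡ 1
    p%2≡1 with p ℕ.% 2 in eq | m%n<n p 2
    ... | 0 | _ with prime⇒irreducible prime (m%n≡0⇒n∣m p 2 eq)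
    ...   | inj₁ ()
    ...   | inj₂ 2≡p = ⊥-elim (ℕ.<-irrefl 2≡p 2<p)
    p%2≡1 | 1 | _ = refl
    p%2≡1 | suc (suc _) | ℕ.s≤s (ℕ.s≤s ())
    p≡1+2h : p ≡ suc (h ℕ.* 2)
    p≡1+2h = trans (m≡m%n+[m/n]*n p 2) (cong (ℕ._+ h ℕ.* 2) p%2≡1)
    r≡h : rOf {p} ≡ h
    r≡h = trans (cong (λ n → (n ∸ 1) ℕ./ 2) p≡1+2h) (m*n/n≡m h 2)

  IsSquare : ℕ → Set
  IsSquare a = ∃ λ (y : Fin p) → y ² ≡ₚ a

  isSquare? : ∀ a → Dec (IsSquare a)
  isSquare? a = any? (λ y → y ² ≟ₚ a)

  IsSquare-resp : ∀ {a b} → a ≡ₚ b → IsSquare a → IsSquare b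
  IsSquare-resp e (y , y²≡a) = y , ≡ₚ-trans y²≡a e

  square-isSquare : ∀ y → IsSquare (y ℕ.* y)
  square-isSquare y = [ y ] , *-congₚ (toℕ-[] y) (toℕ-[] y)

  zero-isSquare : ∀ {a} → a ≡ₚ 0 → IsSquare a
  zero-isSquare e = IsSquare-resp (≡ₚ-sym e) (square-isSquare 0)

  IsSquare-* : ∀ {a b} → IsSquare a → IsSquare b → IsSquare (a ℕ.* b)
  IsSquare-* (y , y²≡a) (z , z²≡b) =
    IsSquare-resp (≡ₚ-trans (≡⇒≡ₚ (interchange (toℕ y) (toℕ z))) (*-congₚ y²≡a z²≡b))
                  (square-isSquare (toℕ y ℕ.* toℕ z))
    where
    interchange : ∀ y z → y ℕ.* z ℕ.* (y ℕ.* z) ≡ y ℕ.* y ℕ.* (z ℕ.* z)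
    interchange = solve-∀

  root-nonzero : ∀ y {x} → ¬ x ≡ₚ 0 → y ℕ.* y ≡ₚ x → ¬ y ≡ₚ 0
  root-nonzero y x≢0 y²≡x y≡0 = x≢0 (≡ₚ-trans (≡ₚ-sym y²≡x) (*-congʳₚ y y≡0))

  IsSquare-cancel : ∀ {n x} → ¬ x ≡ₚ 0 → IsSquare x → IsSquare (n ℕ.* x) → IsSquare n
  IsSquare-cancel {n} {x} x≢0 (y , y²≡x) nx-square =
    IsSquare-resp y'²nx≡n (IsSquare-* (square-isSquare y') nx-square)
    where
    y' = proj₁ (inverseₚ (root-nonzero (toℕ y) x≢0 y²≡x))
    y'y≡1 = proj₂ (inverseₚ (root-nonzero (toℕ y) x≢0 y²≡x))
    rearrange : ∀ y' n y → y' ℕ.* y' ℕ.* (n ℕ.* (y ℕ.* y)) ≡ n ℕ.* (y' ℕ.* y) ℕ.* (y' ℕ.* y)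
    rearrange = solve-∀
    y'²nx≡n : y' ℕ.* y' ℕ.* (n ℕ.* x) ≡ₚ n
    y'²nx≡n = begin
      y' ℕ.* y' ℕ.* (n ℕ.* x)                  ≈⟨ *-congˡₚ (y' ℕ.* y') (*-congˡₚ n y²≡x) ⟨
      y' ℕ.* y' ℕ.* (n ℕ.* (y ²))              ≡⟨ rearrange y' n (toℕ y) ⟩
      n ℕ.* (y' ℕ.* toℕ y) ℕ.* (y' ℕ.* toℕ y)  ≈⟨ *-congₚ (*-congˡₚ n y'y≡1) y'y≡1 ⟩
      n ℕ.* 1 ℕ.* 1                            ≡⟨ trans (ℕ.*-identityʳ _) (ℕ.*-identityʳ n) ⟩
      n                                        ∎
      where open ≡ₚ-Reasoning

  𝟙□ : ℕ → ℤ
  𝟙□ a = if does (isSquare? a) then + 1 else + 0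

  𝟙□-square : ∀ {a} → IsSquare a → 𝟙□ a ≡ + 1
  𝟙□-square {a} a-square with isSquare? a
  ... | yes _ = refl
  ... | no a-nonsquare = ⊥-elim (a-nonsquare a-square)

  𝟙□-nonsquare : ∀ {a} → ¬ IsSquare a → 𝟙□ a ≡ + 0
  𝟙□-nonsquare {a} a-nonsquare with isSquare? a
  ... | yes a-square = ⊥-elim (a-nonsquare a-square)
  ... | no _ = refl

  𝟙□-cong : ∀ {a b} → a ≡ₚ b → 𝟙□ a ≡ 𝟙□ b
  𝟙□-cong {a} {b} e with isSquare? a
  ... | yes a-square = sym (𝟙□-square (IsSquare-resp e a-square))
  ... | no a-nonsquare = sym (𝟙□-nonsquare (a-nonsquare ∘ IsSquare-resp (≡ₚ-sym e)))

  rootCount : Fin p → ℤ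
  rootCount x = sum {p} (λ y → δ [ y ² ] x)

  rootCount-zero : ∀ {x} → toℕ x ≡ₚ 0 → rootCount x ≡ + 1
  rootCount-zero {x} x≡0 = trans (sum-cong-≗ {p} (λ y → δ-ext (to y) (from y))) (sum-δ≡1 x)
    where
    to : ∀ y → x ≡ [ y ² ] → y ≡ x
    to y e = toℕ-injectiveₚ (≡ₚ-trans (square≡0 (toℕ y) (≡ₚ-trans (≡ₚ-sym (≡[]⇒≡ₚ e)) x≡0)) (≡ₚ-sym x≡0))
    from : ∀ y → y ≡ x → x ≡ [ y ² ]
    from y refl = ≡ₚ⇒≡[] (≡ₚ-trans x≡0 (≡ₚ-sym (*-congʳₚ (toℕ y) x≡0)))

  rootCount-nonsquare : ∀ {x} → ¬ IsSquare (toℕ x) → rootCount x ≡ + 0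
  rootCount-nonsquare {x} x-nonsquare =
    trans (sum-cong-≗ {p} (λ y → δ-≢ (not-root y))) (trans (sum-const {p} (+ 0)) (ℤ.*-zeroʳ (+ p)))
    where
    not-root : ∀ y → x ≢ [ y ² ]
    not-root y e = x-nonsquare (y , ≡ₚ-sym (≡[]⇒≡ₚ e))

  double≡0 : ∀ y → y ℕ.+ y ≡ₚ 0 → y ≡ₚ 0
  double≡0 y e with euclidₚ (≡ₚ-trans (≡⇒≡ₚ (cong (y ℕ.+_) (ℕ.+-identityʳ y))) e)
  ... | inj₁ 2≡0 = ⊥-elim (2≢ₚ0 2≡0)
  ... | inj₂ y≡0 = y≡0

  rootCount-square : ∀ {x} → ¬ toℕ x ≡ₚ 0 → IsSquare (toℕ x) → rootCount x ≡ + 2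
  rootCount-square {x} x≢0 (y₀ , y₀²≡x) = begin
    rootCount x                  ≡⟨ sum-cong-≗ {p} roots ⟩
    sum (λ y → δ y₀ y + δ y₁ y)  ≡⟨ ∑-distrib-+ (δ y₀) (δ y₁) ⟩
    sum (δ y₀) + sum (δ y₁)      ≡⟨ cong₂ _+_ (sum-δ≡1 y₀) (sum-δ≡1 y₁) ⟩
    + 2                          ∎
    where
    open ≡-Reasoning
    y₁ = [ -ₚ toℕ y₀ ]
    y₁+y₀≡0 : toℕ y₁ ℕ.+ toℕ y₀ ≡ₚ 0
    y₁+y₀≡0 = ≡ₚ-trans (+-congʳₚ (toℕ y₀) (toℕ-[] _)) (+-inverseˡₚ (toℕ y₀))
    y₀≢y₁ : y₀ ≢ y₁
    y₀≢y₁ e = root-nonzero (toℕ y₀) x≢0 y₀²≡x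
      (double≡0 (toℕ y₀) (≡ₚ-trans (+-congʳₚ (toℕ y₀) (≡⇒≡ₚ (cong toℕ e))) y₁+y₀≡0))
    y₁²≡x : y₁ ² ≡ₚ toℕ x
    y₁²≡x = ≡ₚ-trans (opposite-squares (toℕ y₁) (toℕ y₀) y₁+y₀≡0) y₀²≡x
    root-cases : ∀ y → x ≡ [ y ² ] → y ≡ y₀ ⊎ y ≡ y₁
    root-cases y e with square-rootsₚ (≡ₚ-trans (≡ₚ-sym (≡[]⇒≡ₚ e)) (≡ₚ-sym y₀²≡x))
    ... | inj₁ y≡y₀ = inj₁ (toℕ-injectiveₚ y≡y₀)
    ... | inj₂ y+y₀≡0 = inj₂ (toℕ-injectiveₚ (+-cancelʳₚ (toℕ y₀) (≡ₚ-trans y+y₀≡0 (≡ₚ-sym y₁+y₀≡0))))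
    roots : ∀ y → δ [ y ² ] x ≡ δ y₀ y + δ y₁ y
    roots y with y ≟ᶠ y₀ | y ≟ᶠ y₁
    ... | yes refl | _ =
      trans (δ-≡ (≡ₚ⇒≡[] (≡ₚ-sym y₀²≡x))) (sym (cong₂ _+_ (δ-≡ {i = y₀} refl) (δ-≢ y₀≢y₁)))
    ... | no y≢y₀ | yes refl =
      trans (δ-≡ (≡ₚ⇒≡[] (≡ₚ-sym y₁²≡x))) (sym (cong₂ _+_ (δ-≢ y≢y₀) (δ-≡ {i = y₁} refl)))
    ... | no y≢y₀ | no y≢y₁ =
      trans (δ-≢ λ e → [ y≢y₀ , y≢y₁ ]′ (root-cases y e)) (sym (cong₂ _+_ (δ-≢ y≢y₀) (δ-≢ y≢y₁)))

  δ0-≡ : ∀ {x} → toℕ x ≡ₚ 0 → δ [ 0 ] x ≡ + 1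
  δ0-≡ x≡0 = δ-≡ (≡ₚ⇒≡[] x≡0)

  δ0-≢ : ∀ {x} → ¬ toℕ x ≡ₚ 0 → δ [ 0 ] x ≡ + 0
  δ0-≢ x≢0 = δ-≢ (x≢0 ∘ ≡[]⇒≡ₚ)

  rootCount+δ0 : ∀ x → rootCount x + δ [ 0 ] x ≡ + 2 * 𝟙□ (toℕ x)
  rootCount+δ0 x with toℕ x ≟ₚ 0 | isSquare? (toℕ x)
  ... | yes x≡0 | yes _            = cong₂ _+_ (rootCount-zero x≡0) (δ0-≡ x≡0)
  ... | yes x≡0 | no x-nonsquare   = ⊥-elim (x-nonsquare (zero-isSquare x≡0))
  ... | no x≢0  | yes x-square     = cong₂ _+_ (rootCount-square x≢0 x-square) (δ0-≢ x≢0)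
  ... | no x≢0  | no x-nonsquare   = cong₂ _+_ (rootCount-nonsquare x-nonsquare) (δ0-≢ x≢0)

  sum-rootCount : sum rootCount ≡ + p
  sum-rootCount = begin
    sum rootCount                    ≡⟨ ∑-comm {p} {p} (λ x y → δ [ y ² ] x) ⟩
    sum {p} (λ y → sum (δ [ y ² ]))  ≡⟨ sum-cong-≗ {p} (λ y → sum-δ≡1 [ y ² ]) ⟩
    sum {p} (λ _ → + 1)              ≡⟨ sum-const {p} (+ 1) ⟩
    + p * + 1                        ≡⟨ ℤ.*-identityʳ (+ p) ⟩
    + p                              ∎
    where open ≡-Reasoning

  sum-𝟙□ : + 2 * sum {p} (𝟙□ ∘ toℕ) ≡ + p + + 1
  sum-𝟙□ = begin
    + 2 * sum {p} (𝟙□ ∘ toℕ)                 ≡⟨ *-distribˡ-sum (+ 2) (𝟙□ ∘ toℕ {p}) ⟩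
    sum {p} (λ x → + 2 * 𝟙□ (toℕ x))         ≡⟨ sum-cong-≗ {p} rootCount+δ0 ⟨
    sum {p} (λ x → rootCount x + δ [ 0 ] x)  ≡⟨ ∑-distrib-+ rootCount (δ [ 0 ]) ⟩
    sum rootCount + sum (δ [ 0 ])            ≡⟨ cong₂ _+_ sum-rootCount (sum-δ≡1 [ 0 ]) ⟩
    + p + + 1                                ∎
    where open ≡-Reasoning

  nonresidue : ∃ λ (n : Fin p) → ¬ IsSquare (toℕ n)
  nonresidue with any? (λ n → ¬? (isSquare? (toℕ n)))
  ... | yes found = found
  ... | no none = ⊥-elim (2≮1 (subst (2 ℕ.<_) p≡1 2<p))
    where
    2≮1 : ¬ 2 ℕ.< 1
    2≮1 (ℕ.s≤s ())
    all-squares : ∀ x → 𝟙□ (toℕ x) ≡ + 1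
    all-squares x with isSquare? (toℕ x)
    ... | yes _ = refl
    ... | no x-nonsquare = ⊥-elim (none (x , x-nonsquare))
    double : ∀ a → a ≡ + 2 * a - a
    double = ℤ-Solver.solve-∀
    cancel : ∀ a b → a + b - a ≡ b
    cancel = ℤ-Solver.solve-∀
    p≡1 : p ≡ 1
    p≡1 = ℤ.+-injective (begin
      + p
        ≡⟨ double (+ p) ⟩
      + 2 * + p - + p
        ≡⟨ cong (λ s → + 2 * s - + p) (trans (sum-cong-≗ {p} all-squares) (trans (sum-const {p} (+ 1)) (ℤ.*-identityʳ (+ p)))) ⟨
      + 2 * sum {p} (𝟙□ ∘ toℕ) - + p
        ≡⟨ cong (_- + p) sum-𝟙□ ⟩
      + p + + 1 - + p
        ≡⟨ cancel (+ p) (+ 1) ⟩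
      + 1 ∎)
      where open ≡-Reasoning

  nonsquare-nonzero : ∀ {n} → ¬ IsSquare n → ¬ n ≡ₚ 0
  nonsquare-nonzero n-nonsquare = n-nonsquare ∘ zero-isSquare

  𝟙□-≤1 : ∀ a → 𝟙□ a ℤ.≤ + 1
  𝟙□-≤1 a with isSquare? a
  ... | yes _ = ℤ.≤-refl
  ... | no _ = ℤ.+≤+ ℕ.z≤n

  sum-𝟙□-scaled : ∀ {n} → ¬ n ≡ₚ 0 → sum {p} (λ x → 𝟙□ (n ℕ.* toℕ x)) ≡ sum {p} (𝟙□ ∘ toℕ)
  sum-𝟙□-scaled {n} n≢0 = sym (trans (sum-permute (𝟙□ ∘ toℕ) (affine-permutation n≢0 0))
    (sum-cong-≗ {p} λ x → 𝟙□-cong (≡ₚ-trans (toℕ-[] _) (≡⇒≡ₚ (ℕ.+-identityʳ _)))))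

  module _ {n} (n-nonsquare : ¬ IsSquare n) where

    private
      𝟙□+𝟙□-bound : ∀ x → 𝟙□ (toℕ x) + 𝟙□ (n ℕ.* toℕ x) ℤ.≤ + 1 + δ [ 0 ] x
      𝟙□+𝟙□-bound x with toℕ x ≟ₚ 0 | isSquare? (toℕ x)
      ... | yes x≡0 | yes _ = ℤ.+-monoʳ-≤ (+ 1) (ℤ.≤-reflexive (trans (𝟙□-square (zero-isSquare nx≡0)) (sym (δ0-≡ x≡0))))
        where nx≡0 = ≡ₚ-trans (*-congˡₚ n x≡0) (≡⇒≡ₚ (ℕ.*-zeroʳ n))
      ... | yes x≡0 | no x-nonsquare = ⊥-elim (x-nonsquare (zero-isSquare x≡0))
      ... | no x≢0 | yes x-square =
        ℤ.+-monoʳ-≤ (+ 1) (ℤ.≤-reflexive (trans (𝟙□-nonsquare nx-nonsquare) (sym (δ0-≢ x≢0))))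
        where nx-nonsquare = n-nonsquare ∘ IsSquare-cancel x≢0 x-square
      ... | no x≢0 | no _ = begin
        + 0 + 𝟙□ (n ℕ.* toℕ x)  ≡⟨ ℤ.+-identityˡ _ ⟩
        𝟙□ (n ℕ.* toℕ x)        ≤⟨ 𝟙□-≤1 _ ⟩
        + 1                     ≡⟨ cong (_+_ (+ 1)) (δ0-≢ x≢0) ⟨
        + 1 + δ [ 0 ] x         ∎
        where open ℤ.≤-Reasoning

      sums-≡ : sum {p} (λ x → 𝟙□ (toℕ x) + 𝟙□ (n ℕ.* toℕ x)) ≡ sum {p} (λ x → + 1 + δ [ 0 ] x)
      sums-≡ = begin
        sum {p} (λ x → 𝟙□ (toℕ x) + 𝟙□ (n ℕ.* toℕ x))
          ≡⟨ ∑-distrib-+ {p} (𝟙□ ∘ toℕ) (λ x → 𝟙□ (n ℕ.* toℕ x)) ⟩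
        sum {p} (𝟙□ ∘ toℕ) + sum {p} (λ x → 𝟙□ (n ℕ.* toℕ x))
          ≡⟨ cong (_+_ (sum {p} (𝟙□ ∘ toℕ))) (sum-𝟙□-scaled (nonsquare-nonzero n-nonsquare)) ⟩
        sum {p} (𝟙□ ∘ toℕ) + sum {p} (𝟙□ ∘ toℕ)
          ≡⟨ double (sum {p} (𝟙□ ∘ toℕ)) ⟩
        + 2 * sum {p} (𝟙□ ∘ toℕ)
          ≡⟨ sum-𝟙□ ⟩
        + p + + 1
          ≡⟨ cong₂ _+_ (trans (sum-const {p} (+ 1)) (ℤ.*-identityʳ (+ p))) (sum-δ≡1 [ 0 ]) ⟨
        sum {p} (λ _ → + 1) + sum (δ [ 0 ])
          ≡⟨ ∑-distrib-+ (λ _ → + 1) (δ [ 0 ]) ⟨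
        sum {p} (λ x → + 1 + δ [ 0 ] x) ∎
        where
        open ≡-Reasoning
        double : ∀ a → a + a ≡ + 2 * a
        double = ℤ-Solver.solve-∀

    -- Termwise bounded with equal sums, since Σ 𝟙□(x) + Σ 𝟙□(n x) = p + 1 = Σ (1 + δ₀).
    𝟙□+𝟙□-scaled : ∀ x → 𝟙□ (toℕ x) + 𝟙□ (n ℕ.* toℕ x) ≡ + 1 + δ [ 0 ] x
    𝟙□+𝟙□-scaled = sum-≤-≡ 𝟙□+𝟙□-bound sums-≡

    nonsquare-*-nonsquare : ∀ x → ¬ toℕ x ≡ₚ 0 → ¬ IsSquare (toℕ x) → IsSquare (n ℕ.* toℕ x)
    nonsquare-*-nonsquare x x≢0 x-nonsquare with isSquare? (n ℕ.* toℕ x)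
    ... | yes nx-square = nx-square
    ... | no nx-nonsquare = ⊥-elim (0≢1 (begin
      + 0                            ≡⟨ cong₂ _+_ (𝟙□-nonsquare x-nonsquare) (𝟙□-nonsquare nx-nonsquare) ⟨
      𝟙□ (toℕ x) + 𝟙□ (n ℕ.* toℕ x)  ≡⟨ 𝟙□+𝟙□-scaled x ⟩
      + 1 + δ [ 0 ] x                ≡⟨ cong (_+_ (+ 1)) (δ0-≢ x≢0) ⟩
      + 1                            ∎))
      where
      open ≡-Reasoning
      0≢1 : + 0 ≢ + 1
      0≢1 ()

  rootCount≡2𝟙□-δ0 : ∀ x → rootCount x ≡ + 2 * 𝟙□ (toℕ x) - δ [ 0 ] x
  rootCount≡2𝟙□-δ0 x = trans (sym (cancel (rootCount x) (δ [ 0 ] x))) (cong (_- δ [ 0 ] x) (rootCount+δ0 x))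
    where
    cancel : ∀ a b → a + b - b ≡ a
    cancel = ℤ-Solver.solve-∀

  δ0-scale : ∀ {c} → ¬ c ≡ₚ 0 → ∀ x → δ [ 0 ] [ c ℕ.* toℕ x ] ≡ δ [ 0 ] x
  δ0-scale {c} c≢0 x = δ-ext to from
    where
    to : [ c ℕ.* toℕ x ] ≡ [ 0 ] → x ≡ [ 0 ]
    to e with euclidₚ ([]-injective e)
    ... | inj₁ c≡0 = ⊥-elim (c≢0 c≡0)
    ... | inj₂ x≡0 = ≡ₚ⇒≡[] x≡0
    from : x ≡ [ 0 ] → [ c ℕ.* toℕ x ] ≡ [ 0 ]
    from e = []-cong (≡ₚ-trans (*-congˡₚ c (≡[]⇒≡ₚ e)) (≡⇒≡ₚ (ℕ.*-zeroʳ c)))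

  𝟙□-scale : ∀ {c} → ¬ c ≡ₚ 0 → IsSquare c → ∀ a → 𝟙□ (c ℕ.* a) ≡ 𝟙□ a
  𝟙□-scale {c} c≢0 c-square a with isSquare? a
  ... | yes a-square = 𝟙□-square (IsSquare-* c-square a-square)
  ... | no a-nonsquare = 𝟙□-nonsquare (a-nonsquare ∘ IsSquare-cancel c≢0 c-square ∘ IsSquare-resp (≡⇒≡ₚ (ℕ.*-comm c a)))

module SignsMod4 where
  open import Data.Integer using (_+_; _*_; _-_; -_; ∣_∣)
  open ℤ-Solver using (solve-∀)

  data IsSign : ℤ → Set where
    plus  : IsSign (+ 1)
    minus : IsSign (- + 1)

  ≡1mod4 : ℤ → Set
  ≡1mod4 a = ∃ λ k → a ≡ + 1 + + 4 * k

  2+4m≢0 : ∀ m → + 2 + + 4 * m ≢ + 0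
  2+4m≢0 m e = 4∤2 ∣ m ∣ (begin
    ∣ m ∣ ℕ.* 4  ≡⟨ ℕ.*-comm ∣ m ∣ 4 ⟩
    4 ℕ.* ∣ m ∣  ≡⟨ ℤ.abs-* (+ 4) m ⟨
    ∣ + 4 * m ∣  ≡⟨ cong ∣_∣ (trans (isolate (+ 4 * m)) (cong (_- + 2) e)) ⟩
    2            ∎)
    where
    open ≡-Reasoning
    isolate : ∀ a → a ≡ + 2 + a - + 2
    isolate = solve-∀
    4∤2 : ∀ n → n ℕ.* 4 ≢ 2
    4∤2 zero ()
    4∤2 (suc n) ()

  signs-≡ : ∀ {s t} q → IsSign s → IsSign t → ≡1mod4 (s * q) → ≡1mod4 (t * q) → s ≡ t
  signs-≡ q plus  plus  _ _ = refl
  signs-≡ q minus minus _ _ = refl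
  signs-≡ q plus minus (k , e) (l , e′) = ⊥-elim (2+4m≢0 (k + l) (begin
    + 2 + + 4 * (k + l)                ≡⟨ split k l ⟩
    (+ 1 + + 4 * k) + (+ 1 + + 4 * l)  ≡⟨ cong₂ _+_ e e′ ⟨
    + 1 * q + - + 1 * q                ≡⟨ cancel q ⟩
    + 0                                ∎))
    where
    open ≡-Reasoning
    split : ∀ k l → + 2 + + 4 * (k + l) ≡ (+ 1 + + 4 * k) + (+ 1 + + 4 * l)
    split = solve-∀
    cancel : ∀ q → + 1 * q + - + 1 * q ≡ + 0
    cancel = solve-∀
  signs-≡ q minus plus e e′ = sym (signs-≡ q plus minus e′ e)

  [-1]^-isSign : ∀ r → IsSign ((- + 1) ℤ.^ r)
  [-1]^-isSign zero = plus
  [-1]^-isSign (suc r) with (- + 1) ℤ.^ r | [-1]^-isSign r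
  ... | _ | plus  = minus
  ... | _ | minus = plus

  [-1]^r*[2r+1]≡1+4k : ∀ r → ≡1mod4 ((- + 1) ℤ.^ r * + suc (r ℕ.+ r))
  [-1]^r*[2r+1]≡1+4k zero = + 0 , refl
  [-1]^r*[2r+1]≡1+4k (suc zero) = - + 1 , refl
  [-1]^r*[2r+1]≡1+4k (suc (suc r)) with [-1]^r*[2r+1]≡1+4k r
  ... | k , e = k + u , (begin
    (- + 1) * ((- + 1) * u) * + suc (suc (suc r) ℕ.+ suc (suc r))
      ≡⟨ cong (λ n → (- + 1) * ((- + 1) * u) * n) (trans (cong +_ (shift r)) (ℤ.pos-+ (suc (r ℕ.+ r)) 4)) ⟩
    (- + 1) * ((- + 1) * u) * (+ suc (r ℕ.+ r) + + 4)
      ≡⟨ expand u (+ suc (r ℕ.+ r)) ⟩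
    u * + suc (r ℕ.+ r) + + 4 * u
      ≡⟨ cong (_+ + 4 * u) e ⟩
    + 1 + + 4 * k + + 4 * u
      ≡⟨ collect k u ⟩
    + 1 + + 4 * (k + u) ∎)
    where
    open ≡-Reasoning
    u = (- + 1) ℤ.^ r
    shift : ∀ r → suc (suc (suc r) ℕ.+ suc (suc r)) ≡ suc (r ℕ.+ r) ℕ.+ 4
    shift = ℕ-Solver.solve-∀
    expand : ∀ u q → (- + 1) * ((- + 1) * u) * (q + + 4) ≡ u * q + + 4 * u
    expand = solve-∀
    collect : ∀ k u → + 1 + + 4 * k + + 4 * u ≡ + 1 + + 4 * (k + u)
    collect = solve-∀

module GaussSum (p : ℕ) .{{_ : NonZero p}} (prime : Prime p) (2<p : 2 ℕ.< p) where
  open import Data.Integer using (_+_; _*_; _-_; -_)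
  open ℤ-Solver using (solve-∀)
  open Mod p
  open ModPrime p prime
  open IntegerSums
  open GroupRing p
  open CyclotomicIntegers p
  open QuadraticResidues p prime 2<p
  open SignsMod4

  ω : R
  ω x = 𝟙□ (toℕ x)

  gauss : R
  gauss = sumζ {n = p} (λ y → ζ^ (y ²))

  gauss-apply : ∀ x → gauss x ≡ rootCount x
  gauss-apply = sumζ-apply {p} (λ y → ζ^ (y ²))

  2ω-1≐gauss : ((+ 2) ·ζ ω) -ζ 1ζ ≐ gauss
  2ω-1≐gauss x = begin
    + 2 * 𝟙□ (toℕ x) - 1ζ x       ≡⟨ cong (λ d → + 2 * 𝟙□ (toℕ x) - d) (1ζ≐δ0 x) ⟩
    + 2 * 𝟙□ (toℕ x) - δ [ 0 ] x  ≡⟨ rootCount≡2𝟙□-δ0 x ⟨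
    rootCount x                   ≡⟨ gauss-apply x ⟨
    gauss x                       ∎
    where open ≡-Reasoning

  conj : R
  conj = sumζ {n = p} (λ y → ζ^ ((p ∸ 1) ℕ.* (y ²)))

  negate : Fin p → Fin p
  negate x = [ (p ∸ 1) ℕ.* toℕ x ]

  conj-apply : ∀ x → conj x ≡ rootCount (negate x)
  conj-apply x = trans (sumζ-apply {p} (λ y → ζ^ ((p ∸ 1) ℕ.* (y ²))) x) (sum-cong-≗ {p} λ y → δ-ext (to y) (from y))
    where
    to : ∀ y → x ≡ [ (p ∸ 1) ℕ.* (y ²) ] → negate x ≡ [ y ² ]
    to y e = []-cong ([p-1]-swap (≡[]⇒≡ₚ e))
    from : ∀ y → negate x ≡ [ y ² ] → x ≡ [ (p ∸ 1) ℕ.* (y ²) ]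
    from y e = ≡ₚ⇒≡[] (≡ₚ-sym ([p-1]-swap (≡ₚ-sym ([]-injective e))))

  p-1≢0 : ¬ (p ∸ 1) ≡ₚ 0
  p-1≢0 p-1≡0 = 1≢ₚ0 (≡ₚ-trans (≡ₚ-sym [p-1]²≡ₚ1) (*-congʳₚ (p ∸ 1) p-1≡0))

  conj≐gauss : IsSquare (p ∸ 1) → conj ≐ gauss
  conj≐gauss [p-1]-square x = begin
    conj x
      ≡⟨ conj-apply x ⟩
    rootCount (negate x)
      ≡⟨ rootCount≡2𝟙□-δ0 (negate x) ⟩
    + 2 * 𝟙□ (toℕ (negate x)) - δ [ 0 ] (negate x)
      ≡⟨ cong₂ (λ a b → + 2 * a - b) (trans (𝟙□-cong (toℕ-[] _)) (𝟙□-scale p-1≢0 [p-1]-square (toℕ x)))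
                                     (δ0-scale p-1≢0 x) ⟩
    + 2 * 𝟙□ (toℕ x) - δ [ 0 ] x
      ≡⟨ rootCount≡2𝟙□-δ0 x ⟨
    rootCount x
      ≡⟨ gauss-apply x ⟨
    gauss x ∎
    where open ≡-Reasoning

  conj+gauss≡2 : ¬ IsSquare (p ∸ 1) → ∀ x → conj x + gauss x ≡ + 2
  conj+gauss≡2 [p-1]-nonsquare x = begin
    conj x + gauss x
      ≡⟨ cong₂ _+_ (trans (conj-apply x) (rootCount≡2𝟙□-δ0 (negate x))) (trans (gauss-apply x) (rootCount≡2𝟙□-δ0 x)) ⟩
    (+ 2 * 𝟙□ (toℕ (negate x)) - δ [ 0 ] (negate x)) + (+ 2 * 𝟙□ (toℕ x) - δ [ 0 ] x)
      ≡⟨ cong₂ (λ a b → (+ 2 * a - b) + (+ 2 * 𝟙□ (toℕ x) - δ [ 0 ] x)) (𝟙□-cong (toℕ-[] _)) (δ0-scale p-1≢0 x) ⟩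
    (+ 2 * 𝟙□ ((p ∸ 1) ℕ.* toℕ x) - δ [ 0 ] x) + (+ 2 * 𝟙□ (toℕ x) - δ [ 0 ] x)
      ≡⟨ regroup (𝟙□ (toℕ x)) (𝟙□ ((p ∸ 1) ℕ.* toℕ x)) (δ [ 0 ] x) ⟩
    + 2 * (𝟙□ (toℕ x) + 𝟙□ ((p ∸ 1) ℕ.* toℕ x)) - + 2 * δ [ 0 ] x
      ≡⟨ cong (λ a → + 2 * a - + 2 * δ [ 0 ] x) (𝟙□+𝟙□-scaled [p-1]-nonsquare x) ⟩
    + 2 * (+ 1 + δ [ 0 ] x) - + 2 * δ [ 0 ] x
      ≡⟨ simplify (δ [ 0 ] x) ⟩
    + 2 ∎
    where
    open ≡-Reasoning
    regroup : ∀ a b d → (+ 2 * b - d) + (+ 2 * a - d) ≡ + 2 * (a + b) - + 2 * d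
    regroup = solve-∀
    simplify : ∀ d → + 2 * (+ 1 + d) - + 2 * d ≡ + 2
    simplify = solve-∀

  gauss*conj-double-sum : ∀ x → (gauss *ζ conj) x ≡ sum {p} (λ y → sum {p} (λ z → δ [ y ² ℕ.+ (p ∸ 1) ℕ.* (z ²) ] x))
  gauss*conj-double-sum x = begin
    (gauss *ζ conj) x
      ≡⟨ sumζ-*ζ-sumζ {p} {p} (λ y → ζ^ (y ²)) (λ z → ζ^ ((p ∸ 1) ℕ.* (z ²))) x ⟩
    sumζ {n = p} (λ y → sumζ {n = p} (λ z → ζ^ (y ²) *ζ ζ^ ((p ∸ 1) ℕ.* z ²))) x
      ≡⟨ sumζ-apply {p} _ x ⟩
    sum {p} (λ y → sumζ {n = p} (λ z → ζ^ (y ²) *ζ ζ^ ((p ∸ 1) ℕ.* z ²)) x)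
      ≡⟨ sum-cong-≗ {p} (λ y → trans (sumζ-apply {p} _ x) (sum-cong-≗ {p} (λ z → ζ^-+ (y ²) ((p ∸ 1) ℕ.* z ²) x))) ⟩
    sum {p} (λ y → sum {p} (λ z → δ [ y ² ℕ.+ (p ∸ 1) ℕ.* z ² ] x)) ∎
    where open ≡-Reasoning

  -- y² − z² for y = u + z; for u ≢ 0 it is a bijective function of z.
  private
    E : Fin p → Fin p → ℕ
    E u z = 2 ℕ.* toℕ u ℕ.* toℕ z ℕ.+ u ²

    substitute-y=u+z : ∀ x z → sum {p} (λ y → δ [ y ² ℕ.+ (p ∸ 1) ℕ.* (z ²) ] x) ≡ sum {p} (λ u → δ [ E u z ] x)
    substitute-y=u+z x z =
      trans (sum-permute (λ y → δ [ y ² ℕ.+ (p ∸ 1) ℕ.* (z ²) ] x) (affine-permutation 1≢ₚ0 (toℕ z)))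
            (sum-cong-≗ {p} (λ u → cong (λ w → δ w x) ([]-cong (y²-m1z²≡E u))))
      where
      expand : ∀ u z m → (u ℕ.+ z) ℕ.* (u ℕ.+ z) ℕ.+ m ℕ.* (z ℕ.* z)
                         ≡ (2 ℕ.* u ℕ.* z ℕ.+ u ℕ.* u) ℕ.+ (m ℕ.+ 1) ℕ.* (z ℕ.* z)
      expand = ℕ-Solver.solve-∀
      y²-m1z²≡E : ∀ u → let y = toℕ (affine 1 (toℕ z) u) in y ℕ.* y ℕ.+ (p ∸ 1) ℕ.* (z ²) ≡ₚ E u z
      y²-m1z²≡E u = begin
        y ℕ.* y ℕ.+ (p ∸ 1) ℕ.* (z ²)
          ≈⟨ +-congʳₚ ((p ∸ 1) ℕ.* (z ²)) (*-congₚ y≡u+z y≡u+z) ⟩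
        (toℕ u ℕ.+ toℕ z) ℕ.* (toℕ u ℕ.+ toℕ z) ℕ.+ (p ∸ 1) ℕ.* (z ²)
          ≡⟨ expand (toℕ u) (toℕ z) (p ∸ 1) ⟩
        E u z ℕ.+ ((p ∸ 1) ℕ.+ 1) ℕ.* (z ²)
          ≈⟨ +-congˡₚ (E u z) (*-congʳₚ (z ²) [p-1]+1≡ₚ0) ⟩
        E u z ℕ.+ 0
          ≡⟨ ℕ.+-identityʳ (E u z) ⟩
        E u z ∎
        where
        open ≡ₚ-Reasoning
        y = toℕ (affine 1 (toℕ z) u)
        y≡u+z : y ≡ₚ toℕ u ℕ.+ toℕ z
        y≡u+z = ≡ₚ-trans (toℕ-[] _) (≡⇒≡ₚ (cong (ℕ._+ toℕ z) (ℕ.*-identityˡ (toℕ u))))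

    sum-over-z : ∀ x u → sum {p} (λ z → δ [ E u z ] x) ≡ δ [ 0 ] u * (+ p * δ [ 0 ] x - + 1) + + 1
    sum-over-z x u with toℕ u ≟ₚ 0
    ... | yes u≡0 = begin
      sum {p} (λ z → δ [ E u z ] x)
        ≡⟨ sum-cong-≗ {p} (λ z → cong (λ w → δ w x) ([]-cong (E≡0 z))) ⟩
      sum {p} (λ _ → δ [ 0 ] x)
        ≡⟨ sum-const {p} (δ [ 0 ] x) ⟩
      + p * δ [ 0 ] x
        ≡⟨ one-times-plus-one (+ p * δ [ 0 ] x) ⟩
      + 1 * (+ p * δ [ 0 ] x - + 1) + + 1
        ≡⟨ cong (λ d → d * (+ p * δ [ 0 ] x - + 1) + + 1) (δ0-≡ u≡0) ⟨
      δ [ 0 ] u * (+ p * δ [ 0 ] x - + 1) + + 1 ∎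
      where
      open ≡-Reasoning
      one-times-plus-one : ∀ a → a ≡ + 1 * (a - + 1) + + 1
      one-times-plus-one = solve-∀
      E≡0 : ∀ z → E u z ≡ₚ 0
      E≡0 z = ≡ₚ-trans (+-congₚ (*-congʳₚ (toℕ z) (*-congˡₚ 2 u≡0)) (*-congʳₚ (toℕ u) u≡0))
                       (≡⇒≡ₚ (cong (ℕ._+ 0) (ℕ.*-zeroˡ (toℕ z))))
    ... | no u≢0 = begin
      sum {p} (λ z → δ [ E u z ] x)
        ≡⟨ sum-permute (λ w → δ w x) (affine-permutation 2u≢0 (u ²)) ⟨
      sum {p} (λ w → δ w x)
        ≡⟨ sum-cong-≗ {p} (λ w → δ-sym w x) ⟩
      sum (δ x)
        ≡⟨ sum-δ≡1 x ⟩
      + 1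
        ≡⟨ cong (λ d → d * (+ p * δ [ 0 ] x - + 1) + + 1) (δ0-≢ u≢0) ⟨
      δ [ 0 ] u * (+ p * δ [ 0 ] x - + 1) + + 1 ∎
      where
      open ≡-Reasoning
      2u≢0 : ¬ 2 ℕ.* toℕ u ≡ₚ 0
      2u≢0 = *-nonzeroₚ 2≢ₚ0 u≢0

  gauss*conj-value : ∀ x → (gauss *ζ conj) x ≡ + p * δ [ 0 ] x + (+ p - + 1)
  gauss*conj-value x = begin
    (gauss *ζ conj) x
      ≡⟨ gauss*conj-double-sum x ⟩
    sum {p} (λ y → sum {p} (λ z → δ [ y ² ℕ.+ (p ∸ 1) ℕ.* z ² ] x))
      ≡⟨ ∑-comm {p} {p} (λ y z → δ [ y ² ℕ.+ (p ∸ 1) ℕ.* z ² ] x) ⟩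
    sum {p} (λ z → sum {p} (λ y → δ [ y ² ℕ.+ (p ∸ 1) ℕ.* z ² ] x))
      ≡⟨ sum-cong-≗ {p} (substitute-y=u+z x) ⟩
    sum {p} (λ z → sum {p} (λ u → δ [ E u z ] x))
      ≡⟨ ∑-comm {p} {p} (λ z u → δ [ E u z ] x) ⟩
    sum {p} (λ u → sum {p} (λ z → δ [ E u z ] x))
      ≡⟨ sum-cong-≗ {p} (sum-over-z x) ⟩
    sum {p} (λ u → δ [ 0 ] u * c + + 1)
      ≡⟨ ∑-distrib-+ {p} (λ u → δ [ 0 ] u * c) (λ _ → + 1) ⟩
    sum {p} (λ u → δ [ 0 ] u * c) + sum {p} (λ _ → + 1)
      ≡⟨ cong₂ _+_ (sum-δ [ 0 ] (λ _ → c)) (sum-const {p} (+ 1)) ⟩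
    c + + p * + 1
      ≡⟨ rearrange (+ p) (δ [ 0 ] x) ⟩
    + p * δ [ 0 ] x + (+ p - + 1) ∎
    where
    open ≡-Reasoning
    c = + p * δ [ 0 ] x - + 1
    rearrange : ∀ q d → (q * d - + 1) + q * + 1 ≡ q * d + (q - + 1)
    rearrange = solve-∀

  gauss*conj≈p : gauss *ζ conj ≈ζ fromℤζ (+ p)
  gauss*conj≈p i j = trans (difference i) (sym (difference j))
    where
    cancel : ∀ a b → a + b - a ≡ b
    cancel = solve-∀
    difference : ∀ x → (gauss *ζ conj) x - fromℤζ (+ p) x ≡ + p - + 1
    difference x = trans (cong₂ _-_ (gauss*conj-value x) (fromℤζ-apply (+ p) x)) (cancel (+ p * δ [ 0 ] x) (+ p - + 1))

  fromℤζ-neg : ∀ c → fromℤζ (- c) ≐ -ζ fromℤζ c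
  fromℤζ-neg c i = trans (fromℤζ-apply (- c) i) (trans (sym (ℤ.neg-distribˡ-* c (δ [ 0 ] i))) (cong -_ (sym (fromℤζ-apply c i))))

  conj≈-gauss : ¬ IsSquare (p ∸ 1) → conj ≈ζ -ζ gauss
  conj≈-gauss [p-1]-nonsquare i j = trans (difference i) (sym (difference j))
    where
    difference : ∀ x → conj x - - gauss x ≡ + 2
    difference x = trans (cong (_+_ (conj x)) (ℤ.neg-involutive (gauss x))) (conj+gauss≡2 [p-1]-nonsquare x)

  private
    module ℤ[ζ] = CommutativeRing ℤ[ζ]
    open import Algebra.Properties.Ring ℤ[ζ].ring using (-‿involutive; -‿distribʳ-*)

  gauss²≈±p : ∃ λ s → IsSign s × gauss *ζ gauss ≈ζ fromℤζ (s * + p)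
  gauss²≈±p with isSquare? (p ∸ 1)
  ... | yes [p-1]-square = + 1 , plus , (begin
    gauss *ζ gauss
      ≈⟨ ≐⇒≈ζ (*ζ-cong {gauss} {gauss} {gauss} {conj} (λ _ → refl) (λ i → sym (conj≐gauss [p-1]-square i))) ⟩
    gauss *ζ conj
      ≈⟨ gauss*conj≈p ⟩
    fromℤζ (+ p)
      ≡⟨ cong fromℤζ (ℤ.*-identityˡ (+ p)) ⟨
    fromℤζ (+ 1 * + p) ∎)
    where open SetoidReasoning ℤ[ζ].setoid
  ... | no [p-1]-nonsquare = - + 1 , minus , (begin
    gauss *ζ gauss
      ≈⟨ -‿involutive (gauss *ζ gauss) ⟨
    -ζ (-ζ (gauss *ζ gauss))
      ≈⟨ ℤ[ζ].-‿cong { -ζ (gauss *ζ gauss)} {gauss *ζ -ζ gauss} (-‿distribʳ-* gauss gauss) ⟩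
    -ζ (gauss *ζ -ζ gauss)
      ≈⟨ ℤ[ζ].-‿cong {gauss *ζ conj} {gauss *ζ -ζ gauss}
           (ℤ[ζ].*-congˡ {gauss} {conj} { -ζ gauss} (conj≈-gauss [p-1]-nonsquare)) ⟨
    -ζ (gauss *ζ conj)
      ≈⟨ ℤ[ζ].-‿cong {gauss *ζ conj} {fromℤζ (+ p)} gauss*conj≈p ⟩
    -ζ fromℤζ (+ p)
      ≈⟨ ≐⇒≈ζ (fromℤζ-neg (+ p)) ⟨
    fromℤζ (- + p)
      ≡⟨ cong fromℤζ (ℤ.-1*i≡-i (+ p)) ⟨
    fromℤζ (- + 1 * + p) ∎)
    where open SetoidReasoning ℤ[ζ].setoid


  η : R
  η x = 𝟙□ (toℕ x) - δ [ 0 ] x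

  gauss≐1+2η : gauss ≐ 1ζ +ζ (η +ζ η)
  gauss≐1+2η x = begin
    gauss x                       ≡⟨ trans (gauss-apply x) (rootCount≡2𝟙□-δ0 x) ⟩
    + 2 * 𝟙□ (toℕ x) - δ [ 0 ] x  ≡⟨ split (𝟙□ (toℕ x)) (δ [ 0 ] x) ⟩
    δ [ 0 ] x + (η x + η x)       ≡⟨ cong (_+ (η x + η x)) (1ζ≐δ0 x) ⟨
    1ζ x + (η x + η x)            ∎
    where
    open ≡-Reasoning
    split : ∀ s d → + 2 * s - d ≡ d + ((s - d) + (s - d))
    split = solve-∀

  square-1+2e : ∀ e x → ((1ζ +ζ (e +ζ e)) *ζ (1ζ +ζ (e +ζ e))) x ≡ 1ζ x + + 4 * (e x + (e *ζ e) x)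
  square-1+2e e x = begin
    ((1ζ +ζ b) *ζ (1ζ +ζ b)) x
      ≡⟨ C.distribʳ (1ζ +ζ b) 1ζ b x ⟩
    (1ζ *ζ (1ζ +ζ b)) x + (b *ζ (1ζ +ζ b)) x
      ≡⟨ cong₂ _+_ (C.*-identityˡ (1ζ +ζ b) x) (C.distribˡ b 1ζ b x) ⟩
    (1ζ x + b x) + ((b *ζ 1ζ) x + (b *ζ b) x)
      ≡⟨ cong (λ t → (1ζ x + b x) + (t + (b *ζ b) x)) (C.*-identityʳ b x) ⟩
    (1ζ x + b x) + (b x + (b *ζ b) x)
      ≡⟨ cong (λ t → (1ζ x + b x) + (b x + t)) b² ⟩
    (1ζ x + b x) + (b x + ((q + q) + (q + q)))
      ≡⟨ collect (1ζ x) (e x) q ⟩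
    1ζ x + + 4 * (e x + q) ∎
    where
    open ≡-Reasoning
    module C = CommutativeRing ℤ[Cₚ]
    b = e +ζ e
    q = (e *ζ e) x
    b² : (b *ζ b) x ≡ (q + q) + (q + q)
    b² = trans (C.distribʳ b e e x) (cong₂ _+_ (C.distribˡ e e e x) (C.distribˡ e e e x))
    collect : ∀ u a q → (u + (a + a)) + ((a + a) + ((q + q) + (q + q))) ≡ u + + 4 * (a + q)
    collect = solve-∀

  δ0-[0] : δ [ 0 ] [ 0 ] ≡ + 1
  δ0-[0] = δ-≡ {i = [ 0 ]} refl

  δ0-[1] : δ [ 0 ] [ 1 ] ≡ + 0
  δ0-[1] = δ0-≢ (1≢ₚ0 ∘ ≡ₚ-trans (≡ₚ-sym (toℕ-[] 1)))

  gap : R → ℤ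
  gap f = f [ 0 ] - f [ 1 ]

  ≈ζ⇒gap≡ : ∀ {f g} → f ≈ζ g → gap f ≡ gap g
  ≈ζ⇒gap≡ {f} {g} f≈g = begin
    f [ 0 ] - f [ 1 ]
      ≡⟨ regroup (f [ 0 ]) (f [ 1 ]) (g [ 0 ]) (g [ 1 ]) ⟩
    (g [ 0 ] - g [ 1 ]) + ((f [ 0 ] - g [ 0 ]) - (f [ 1 ] - g [ 1 ]))
      ≡⟨ cong (λ t → (g [ 0 ] - g [ 1 ]) + t) (ℤ.i≡j⇒i-j≡0 (f≈g [ 0 ] [ 1 ])) ⟩
    (g [ 0 ] - g [ 1 ]) + + 0
      ≡⟨ ℤ.+-identityʳ _ ⟩
    g [ 0 ] - g [ 1 ] ∎
    where
    open ≡-Reasoning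
    regroup : ∀ f₀ f₁ g₀ g₁ → f₀ - f₁ ≡ (g₀ - g₁) + ((f₀ - g₀) - (f₁ - g₁))
    regroup = solve-∀

  gap-fromℤζ : ∀ c → gap (fromℤζ c) ≡ c
  gap-fromℤζ c = begin
    fromℤζ c [ 0 ] - fromℤζ c [ 1 ]        ≡⟨ cong₂ _-_ (fromℤζ-apply c [ 0 ]) (fromℤζ-apply c [ 1 ]) ⟩
    c * δ [ 0 ] [ 0 ] - c * δ [ 0 ] [ 1 ]  ≡⟨ cong₂ (λ a b → c * a - c * b) δ0-[0] δ0-[1] ⟩
    c * + 1 - c * + 0                      ≡⟨ simplify c ⟩
    c                                      ∎
    where
    open ≡-Reasoning
    simplify : ∀ c → c * + 1 - c * + 0 ≡ c
    simplify = solve-∀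

  -- gap kills the norm element, so it reads c off G² ≈ c; G = 1 + 2η makes G² ≡ 1 (mod 4).
  gauss²-mod4 : ∀ {c} → gauss *ζ gauss ≈ζ fromℤζ c → ≡1mod4 c
  gauss²-mod4 {c} G²≈c = a [ 0 ] - a [ 1 ] , (begin
    c
      ≡⟨ gap-fromℤζ c ⟨
    gap (fromℤζ c)
      ≡⟨ ≈ζ⇒gap≡ {gauss *ζ gauss} {fromℤζ c} G²≈c ⟨
    gap (gauss *ζ gauss)
      ≡⟨ cong₂ _-_ (expand [ 0 ]) (expand [ 1 ]) ⟩
    (1ζ [ 0 ] + + 4 * a [ 0 ]) - (1ζ [ 1 ] + + 4 * a [ 1 ])
      ≡⟨ cong₂ (λ u v → (u + + 4 * a [ 0 ]) - (v + + 4 * a [ 1 ])) (trans (1ζ≐δ0 [ 0 ]) δ0-[0]) (trans (1ζ≐δ0 [ 1 ]) δ0-[1]) ⟩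
    (+ 1 + + 4 * a [ 0 ]) - (+ 0 + + 4 * a [ 1 ])
      ≡⟨ collect (a [ 0 ]) (a [ 1 ]) ⟩
    + 1 + + 4 * (a [ 0 ] - a [ 1 ]) ∎)
    where
    open ≡-Reasoning
    a = η +ζ η *ζ η
    expand : ∀ x → (gauss *ζ gauss) x ≡ 1ζ x + + 4 * a x
    expand x = trans (*ζ-cong gauss≐1+2η gauss≐1+2η x) (square-1+2e η x)
    collect : ∀ a₀ a₁ → (+ 1 + + 4 * a₀) - (+ 0 + + 4 * a₁) ≡ + 1 + + 4 * (a₀ - a₁)
    collect = solve-∀

  gauss²≈εp : gauss *ζ gauss ≈ζ fromℤζ (εp {p})
  gauss²≈εp with gauss²≈±p
  ... | s , s-sign , G²≈sp =
    ≈ζ-trans {gauss *ζ gauss} {fromℤζ (s * + p)} G²≈sp (≐⇒≈ζ (λ i → cong (λ c → fromℤζ c i) sp≡εp))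
    where
    [-1]^r*p≡1mod4 : ≡1mod4 ((- + 1) ℤ.^ rOf {p} * + p)
    [-1]^r*p≡1mod4 = subst (λ n → ≡1mod4 ((- + 1) ℤ.^ rOf {p} * + n)) (sym p≡2r+1) ([-1]^r*[2r+1]≡1+4k (rOf {p}))
    sp≡εp : s * + p ≡ εp {p}
    sp≡εp = cong (_* + p) (signs-≡ (+ p) s-sign ([-1]^-isSign (rOf {p})) (gauss²-mod4 G²≈sp) [-1]^r*p≡1mod4)

module RootPolynomial {c ℓ} (R : CommutativeRing c ℓ) where
  open CommutativeRing R renaming (refl to ≈-refl; sym to ≈-sym; trans to ≈-trans) hiding (zero)
  open SetoidReasoning setoid
  open import Algebra.Definitions.RawSemiring (Semiring.rawSemiring semiring) public using (_^_)
  open import Algebra.Properties.Ring ring using (-‿distribˡ-*; -‿distribʳ-*; -1*x≈-x)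
  open import Algebra.Properties.Group (AbelianGroup.group +-abelianGroup) using (inverseʳ-unique)
  open NonReflective (fromCommutativeRing R (λ _ → nothing)) using (solve; _⊜_; _⊕_; ⊝_) renaming (_⊗_ to _⊙_)
  open import Algebra.Properties.Semiring.Sum semiring public using (sum)
  open import Algebra.Properties.Semiring.Sum semiring using (sum-cong-≋; ∑-distrib-+; *-distribˡ-sum)

  Poly : Set c
  Poly = ℕ → Carrier

  infix 4 _≋_
  _≋_ : Poly → Poly → Set ℓ
  P ≋ Q = ∀ k → P k ≈ Q k

  shift : Poly → Poly
  shift Q zero = 0#
  shift Q (suc k) = Q k

  [x-_]*_ : Carrier → Poly → Poly
  ([x- a ]* Q) k = shift Q k - a * Q k

  [x-]*-cong : ∀ {a b P Q} → a ≈ b → P ≋ Q → [x- a ]* P ≋ [x- b ]* Q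
  [x-]*-cong a≈b P≋Q zero = +-congˡ (-‿cong (*-cong a≈b (P≋Q zero)))
  [x-]*-cong a≈b P≋Q (suc k) = +-cong (P≋Q k) (-‿cong (*-cong a≈b (P≋Q (suc k))))

  [x-]*-comm : ∀ a b Q → [x- a ]* ([x- b ]* Q) ≋ [x- b ]* ([x- a ]* Q)
  [x-]*-comm a b Q zero = begin
    0# - a * (0# - b * Q 0)
      ≈⟨ +-identityˡ _ ⟩
    - (a * (0# - b * Q 0))
      ≈⟨ -‿cong (*-congˡ (+-identityˡ _)) ⟩
    - (a * - (b * Q 0))
      ≈⟨ solve 3 (λ a b q → (⊝ (a ⊙ ⊝ (b ⊙ q))) ⊜ (⊝ (b ⊙ ⊝ (a ⊙ q)))) ≈-refl a b (Q 0) ⟩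
    - (b * - (a * Q 0))
      ≈⟨ -‿cong (*-congˡ (+-identityˡ _)) ⟨
    - (b * (0# - a * Q 0))
      ≈⟨ +-identityˡ _ ⟨
    0# - b * (0# - a * Q 0) ∎
  [x-]*-comm a b Q (suc k) =
    solve 5 (λ a b s q q′ → ((s ⊕ ⊝ (b ⊙ q)) ⊕ ⊝ (a ⊙ (q ⊕ ⊝ (b ⊙ q′))))
                          ⊜ ((s ⊕ ⊝ (a ⊙ q)) ⊕ ⊝ (b ⊙ (q ⊕ ⊝ (a ⊙ q′)))))
            ≈-refl a b (shift Q k) (Q k) (Q (suc k))

  one : Poly
  one zero = 1#
  one (suc _) = 0#

  ∏[x-_] : List Carrier → Poly
  ∏[x- xs ] = List.foldr [x-_]*_ one xs

  ∏-↭ : ∀ {xs ys} → xs ↭ ys → ∏[x- xs ] ≋ ∏[x- ys ]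
  ∏-↭ ↭.refl k = ≈-refl
  ∏-↭ (↭.prep x p) = [x-]*-cong ≈-refl (∏-↭ p)
  ∏-↭ (↭.swap {ys = ys} x y p) k = ≈-trans ([x-]*-cong ≈-refl ([x-]*-cong ≈-refl (∏-↭ p)) k) ([x-]*-comm x y ∏[x- ys ] k)
  ∏-↭ (↭.trans p q) k = ≈-trans (∏-↭ p k) (∏-↭ q k)

  tabulate-↭ : ∀ {m} (α : Fin m → Carrier) (π : Permutation m m) → tabulate (α ∘ (π ⟨$⟩ʳ_)) ↭ tabulate α
  tabulate-↭ α π = ↭.↭-sym (≡.subst₂ _↭_ (tabulate-as-sum α) (tabulate-as-sum (α ∘ (π ⟨$⟩ʳ_)))
                                        (ListSum.sum-permute (λ j → List.[ α j ]) π))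
    where
    module ListSum = MonoidSum (++-commutativeMonoid {A = Carrier})
    tabulate-as-sum : ∀ {m} (α : Fin m → Carrier) → ListSum.sum (λ j → List.[ α j ]) ≡.≡ tabulate α
    tabulate-as-sum {zero} α = ≡.refl
    tabulate-as-sum {suc m} α = ≡.cong (α Fin.zero ∷_) (tabulate-as-sum (α ∘ Fin.suc))

  ∏ᶠ[x-_] : ∀ {m} → (Fin m → Carrier) → Poly
  ∏ᶠ[x- α ] = ∏[x- tabulate α ]

  ∏ᶠ-permute : ∀ {m} (α : Fin m → Carrier) (π : Permutation m m) → ∏ᶠ[x- α ∘ (π ⟨$⟩ʳ_) ] ≋ ∏ᶠ[x- α ]
  ∏ᶠ-permute α π = ∏-↭ (tabulate-↭ α π)

  ∏ᶠ-cong : ∀ {m} {α β : Fin m → Carrier} → (∀ j → α j ≈ β j) → ∏ᶠ[x- α ] ≋ ∏ᶠ[x- β ]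
  ∏ᶠ-cong {zero} α≈β k = ≈-refl
  ∏ᶠ-cong {suc m} α≈β = [x-]*-cong (α≈β Fin.zero) (∏ᶠ-cong (α≈β ∘ Fin.suc))

  x-a*0≈x : ∀ x a → x - a * 0# ≈ x
  x-a*0≈x x a = begin
    x - a * 0#  ≈⟨ +-congˡ (-‿cong (zeroʳ a)) ⟩
    x - 0#      ≈⟨ +-congˡ (≈-trans (≈-sym (+-identityˡ (- 0#))) (-‿inverseʳ 0#)) ⟩
    x + 0#      ≈⟨ +-identityʳ x ⟩
    x           ∎

  ∏ᶠ-vanishes : ∀ {m} (α : Fin m → Carrier) {k} → m < k → ∏ᶠ[x- α ] k ≈ 0#
  ∏ᶠ-vanishes {zero} α {suc k} _ = ≈-refl
  ∏ᶠ-vanishes {suc m} α {suc k} (s≤s m<k) = begin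
    ∏ᶠ[x- α ∘ Fin.suc ] k - α Fin.zero * ∏ᶠ[x- α ∘ Fin.suc ] (suc k)
      ≈⟨ +-cong (∏ᶠ-vanishes (α ∘ Fin.suc) m<k) (-‿cong (*-congˡ (∏ᶠ-vanishes (α ∘ Fin.suc) (ℕ.m<n⇒m<1+n m<k)))) ⟩
    0# - α Fin.zero * 0#
      ≈⟨ x-a*0≈x 0# (α Fin.zero) ⟩
    0# ∎

  ∏ᶠ-monic : ∀ {m} (α : Fin m → Carrier) → ∏ᶠ[x- α ] m ≈ 1#
  ∏ᶠ-monic {zero} α = ≈-refl
  ∏ᶠ-monic {suc m} α = begin
    ∏ᶠ[x- α ∘ Fin.suc ] m - α Fin.zero * ∏ᶠ[x- α ∘ Fin.suc ] (suc m)
      ≈⟨ +-cong (∏ᶠ-monic (α ∘ Fin.suc)) (-‿cong (*-congˡ (∏ᶠ-vanishes (α ∘ Fin.suc) (ℕ.n<1+n m)))) ⟩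
    1# - α Fin.zero * 0#
      ≈⟨ x-a*0≈x 1# (α Fin.zero) ⟩
    1# ∎

  sumTo : ℕ → (ℕ → Carrier) → Carrier
  sumTo n g = sum {n} (g ∘ toℕ)

  sumTo-cong : ∀ n {g h} → (∀ l → g l ≈ h l) → sumTo n g ≈ sumTo n h
  sumTo-cong n g≈h = sum-cong-≋ {n} (g≈h ∘ toℕ)

  sumTo-suc : ∀ n g → sumTo (suc n) g ≈ sumTo n g + g n
  sumTo-suc zero g = ≈-trans (+-identityʳ (g 0)) (≈-sym (+-identityˡ (g 0)))
  sumTo-suc (suc n) g = ≈-trans (+-congˡ (sumTo-suc n (g ∘ suc))) (≈-sym (+-assoc (g 0) _ _))

  eval : ℕ → Poly → Carrier → Carrier
  eval n Q z = sumTo n (λ l → z ^ l * Q l)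

  eval-[x-]* : ∀ n a Q z → Q n ≈ 0# → eval (suc n) ([x- a ]* Q) z ≈ (z - a) * eval n Q z
  eval-[x-]* n a Q z Qn≈0 = begin
    sumTo (suc n) (λ l → z ^ l * (shift Q l - a * Q l))
      ≈⟨ sumTo-cong (suc n) (λ l → split (z ^ l) (shift Q l) a (Q l)) ⟩
    sumTo (suc n) (λ l → z ^ l * shift Q l + - a * (z ^ l * Q l))
      ≈⟨ ∑-distrib-+ {suc n} (λ l → z ^ toℕ l * shift Q (toℕ l)) (λ l → - a * (z ^ toℕ l * Q (toℕ l))) ⟩
    sumTo (suc n) (λ l → z ^ l * shift Q l) + sumTo (suc n) (λ l → - a * (z ^ l * Q l))
      ≈⟨ +-cong shifted (≈-sym (*-distribˡ-sum {suc n} (- a) (λ l → z ^ toℕ l * Q (toℕ l)))) ⟩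
    (1# * 0# + sumTo n (λ l → z * (z ^ l * Q l))) + - a * eval (suc n) Q z
      ≈⟨ +-cong (+-cong (zeroʳ 1#) (≈-sym (*-distribˡ-sum {n} z (λ l → z ^ toℕ l * Q (toℕ l)))))
                (*-congˡ (sumTo-suc n (λ l → z ^ l * Q l))) ⟩
    (0# + z * E) + - a * (E + z ^ n * Q n)
      ≈⟨ +-cong (+-identityˡ (z * E)) (*-congˡ (+-congˡ (≈-trans (*-congˡ Qn≈0) (zeroʳ (z ^ n))))) ⟩
    z * E + - a * (E + 0#)
      ≈⟨ +-congˡ (*-congˡ (+-identityʳ E)) ⟩
    z * E + - a * E
      ≈⟨ distribʳ E z (- a) ⟨
    (z - a) * E ∎
    where
    E = eval n Q z
    split : ∀ w s a q → w * (s - a * q) ≈ w * s + - a * (w * q)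
    split w s a q = begin
      w * (s - a * q)
        ≈⟨ distribˡ w s (- (a * q)) ⟩
      w * s + w * - (a * q)
        ≈⟨ +-congˡ (-‿distribʳ-* w (a * q)) ⟨
      w * s + - (w * (a * q))
        ≈⟨ +-congˡ (-‿cong (solve 3 (λ w a q → (w ⊙ (a ⊙ q)) ⊜ (a ⊙ (w ⊙ q))) ≈-refl w a q)) ⟩
      w * s + - (a * (w * q))
        ≈⟨ +-congˡ (-‿distribˡ-* a (w * q)) ⟩
      w * s + - a * (w * q) ∎
    shifted : sumTo (suc n) (λ l → z ^ l * shift Q l) ≈ 1# * 0# + sumTo n (λ l → z * (z ^ l * Q l))
    shifted = +-congˡ (sumTo-cong n (λ l → *-assoc z (z ^ l) (Q l)))

  ∏ᶠ-root : ∀ {m} (α : Fin m → Carrier) j → eval (suc m) ∏ᶠ[x- α ] (α j) ≈ 0#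
  ∏ᶠ-root {suc m} α j = begin
    eval (suc (suc m)) ∏ᶠ[x- α ] (α j)
      ≈⟨ eval-[x-]* (suc m) (α Fin.zero) ∏ᶠ[x- α ∘ Fin.suc ] (α j) (∏ᶠ-vanishes (α ∘ Fin.suc) (ℕ.n<1+n m)) ⟩
    (α j - α Fin.zero) * eval (suc m) ∏ᶠ[x- α ∘ Fin.suc ] (α j)
      ≈⟨ factor-vanishes j ⟩
    0# ∎
    where
    factor-vanishes : ∀ j → (α j - α Fin.zero) * eval (suc m) ∏ᶠ[x- α ∘ Fin.suc ] (α j) ≈ 0#
    factor-vanishes Fin.zero = ≈-trans (*-congʳ (-‿inverseʳ (α Fin.zero))) (zeroˡ _)
    factor-vanishes (Fin.suc j) = ≈-trans (*-congˡ (∏ᶠ-root (α ∘ Fin.suc) j)) (zeroʳ _)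

  ∏ᶠ-companion : ∀ {m} (α : Fin m → Carrier) j → sumTo m (λ l → α j ^ l * - ∏ᶠ[x- α ] l) ≈ α j ^ m
  ∏ᶠ-companion {m} α j = begin
    sumTo m (λ l → z ^ l * - P l)
      ≈⟨ sumTo-cong m (λ l → ≈-trans (≈-sym (-‿distribʳ-* (z ^ l) (P l))) (≈-sym (-1*x≈-x (z ^ l * P l)))) ⟩
    sumTo m (λ l → - 1# * (z ^ l * P l))
      ≈⟨ *-distribˡ-sum {m} (- 1#) (λ l → z ^ toℕ l * P (toℕ l)) ⟨
    - 1# * eval m P z
      ≈⟨ -1*x≈-x (eval m P z) ⟩
    - eval m P z
      ≈⟨ inverseʳ-unique (eval m P z) (z ^ m) root ⟨
    z ^ m ∎
    where
    z = α j
    P = ∏ᶠ[x- α ]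
    root : eval m P z + z ^ m ≈ 0#
    root = begin
      eval m P z + z ^ m
        ≈⟨ +-congˡ (≈-trans (≈-sym (*-identityʳ (z ^ m))) (*-congˡ (≈-sym (∏ᶠ-monic α)))) ⟩
      eval m P z + z ^ m * P m
        ≈⟨ sumTo-suc m (λ l → z ^ l * P l) ⟨
      eval (suc m) P z
        ≈⟨ ∏ᶠ-root α j ⟩
      0# ∎

  module _ {h : Carrier → Carrier} (h-hom : IsRingHomomorphism rawRing rawRing h) where
    open IsRingHomomorphism h-hom using (+-homo; 0#-homo; *-homo; 1#-homo; -‿homo)

    ∏ᶠ-homomorphic : ∀ {m} (α : Fin m → Carrier) k → h (∏ᶠ[x- α ] k) ≈ ∏ᶠ[x- h ∘ α ] k
    ∏ᶠ-homomorphic {zero} α zero = 1#-homo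
    ∏ᶠ-homomorphic {zero} α (suc k) = 0#-homo
    ∏ᶠ-homomorphic {suc m} α k = begin
      h (shift Q k - a * Q k)
        ≈⟨ +-homo (shift Q k) (- (a * Q k)) ⟩
      h (shift Q k) + h (- (a * Q k))
        ≈⟨ +-cong (shift-homomorphic k) (≈-trans (-‿homo (a * Q k)) (-‿cong product-homomorphic)) ⟩
      shift Q′ k - h a * Q′ k ∎
      where
      a = α Fin.zero
      Q = ∏ᶠ[x- α ∘ Fin.suc ]
      Q′ = ∏ᶠ[x- h ∘ α ∘ Fin.suc ]
      product-homomorphic : h (a * Q k) ≈ h a * Q′ k
      product-homomorphic = ≈-trans (*-homo a (Q k)) (*-congˡ (∏ᶠ-homomorphic (α ∘ Fin.suc) k))
      shift-homomorphic : ∀ k → h (shift Q k) ≈ shift Q′ k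
      shift-homomorphic zero = 0#-homo
      shift-homomorphic (suc k) = ∏ᶠ-homomorphic (α ∘ Fin.suc) k

module Dilation (p : ℕ) .{{_ : NonZero p}} (prime : Prime p) where
  open import Data.Integer using (_*_)
  open Mod p
  open ModPrime p prime
  open IntegerSums
  open GroupRing p

  -- The automorphism ζ ↦ ζ^(u⁻¹) of ℤ[ζ_p].
  dilate : ℕ → R → R
  dilate u f x = f [ u ℕ.* toℕ x ]

  affine-u0 : ∀ u j → affine u 0 j ≡ [ u ℕ.* toℕ j ]
  affine-u0 u j = []-cong (≡⇒≡ₚ (ℕ.+-identityʳ _))

  ⊖-dilate : ∀ u i j → [ u ℕ.* toℕ i ] ⊖ [ u ℕ.* toℕ j ] ≡ [ u ℕ.* toℕ (i ⊖ j) ]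
  ⊖-dilate u i j = sym (⊖-unique (begin
    toℕ [ u ℕ.* toℕ (i ⊖ j) ] ℕ.+ toℕ [ u ℕ.* toℕ j ]  ≈⟨ +-congₚ (toℕ-[] _) (toℕ-[] _) ⟩
    u ℕ.* toℕ (i ⊖ j) ℕ.+ u ℕ.* toℕ j                  ≡⟨ ℕ.*-distribˡ-+ u (toℕ (i ⊖ j)) (toℕ j) ⟨
    u ℕ.* (toℕ (i ⊖ j) ℕ.+ toℕ j)                      ≈⟨ *-congˡₚ u (⊖-spec i j) ⟩
    u ℕ.* toℕ i                                        ≈⟨ toℕ-[] _ ⟨
    toℕ [ u ℕ.* toℕ i ]                                ∎))
    where open ≡ₚ-Reasoning

  module _ {u} (u≢0 : ¬ u ≡ₚ 0) where

    dilate-* : ∀ f g → dilate u (f *ζ g) ≐ dilate u f *ζ dilate u g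
    dilate-* f g i = begin
      (f *ζ g) [ u ℕ.* toℕ i ]
        ≡⟨ *ζ-apply f g _ ⟩
      sum {p} (λ j → f j * g ([ u ℕ.* toℕ i ] ⊖ j))
        ≡⟨ sum-permute (λ j → f j * g ([ u ℕ.* toℕ i ] ⊖ j)) (affine-permutation u≢0 0) ⟩
      sum {p} (λ j → f (affine u 0 j) * g ([ u ℕ.* toℕ i ] ⊖ affine u 0 j))
        ≡⟨ sum-cong-≗ {p} (λ j → cong (λ k → f k * g ([ u ℕ.* toℕ i ] ⊖ k)) (affine-u0 u j)) ⟩
      sum {p} (λ j → f [ u ℕ.* toℕ j ] * g ([ u ℕ.* toℕ i ] ⊖ [ u ℕ.* toℕ j ]))
        ≡⟨ sum-cong-≗ {p} (λ j → cong (λ k → f [ u ℕ.* toℕ j ] * g k) (⊖-dilate u i j)) ⟩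
      sum {p} (λ j → f [ u ℕ.* toℕ j ] * g [ u ℕ.* toℕ (i ⊖ j) ])
        ≡⟨ *ζ-apply (dilate u f) (dilate u g) i ⟨
      (dilate u f *ζ dilate u g) i ∎
      where open ≡-Reasoning

  dilate-ζ^ : ∀ u u' → u' ℕ.* u ≡ₚ 1 → ∀ a → dilate u (ζ^ a) ≐ ζ^ (u' ℕ.* a)
  dilate-ζ^ u u' u'u≡1 a x = δ-ext to from
    where
    open ≡ₚ-Reasoning
    cancel : ∀ {b} → b ≡ₚ 1 ℕ.* b
    cancel {b} = ≡⇒≡ₚ (sym (ℕ.*-identityˡ b))
    to : [ u ℕ.* toℕ x ] ≡ [ a ] → x ≡ [ u' ℕ.* a ]
    to e = ≡ₚ⇒≡[] (begin
      toℕ x                 ≈⟨ cancel ⟩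
      1 ℕ.* toℕ x           ≈⟨ *-congʳₚ (toℕ x) u'u≡1 ⟨
      u' ℕ.* u ℕ.* toℕ x    ≡⟨ ℕ.*-assoc u' u (toℕ x) ⟩
      u' ℕ.* (u ℕ.* toℕ x)  ≈⟨ *-congˡₚ u' ([]-injective e) ⟩
      u' ℕ.* a              ∎)
    from : x ≡ [ u' ℕ.* a ] → [ u ℕ.* toℕ x ] ≡ [ a ]
    from e = []-cong (begin
      u ℕ.* toℕ x       ≈⟨ *-congˡₚ u (≡[]⇒≡ₚ e) ⟩
      u ℕ.* (u' ℕ.* a)  ≡⟨ ℕ.*-assoc u u' a ⟨
      u ℕ.* u' ℕ.* a    ≈⟨ *-congʳₚ a (≡ₚ-trans (≡⇒≡ₚ (ℕ.*-comm u u')) u'u≡1) ⟩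
      1 ℕ.* a           ≈⟨ cancel ⟨
      a                 ∎)

  dilate-1 : ∀ {u} → ¬ u ≡ₚ 0 → dilate u 1ζ ≐ 1ζ
  dilate-1 {u} u≢0 x = begin
    1ζ [ u ℕ.* toℕ x ]    ≡⟨ 1ζ≐δ0 [ u ℕ.* toℕ x ] ⟩
    ζ^ 0 [ u ℕ.* toℕ x ]  ≡⟨ dilate-ζ^ u u' u'u≡1 0 x ⟩
    ζ^ (u' ℕ.* 0) x       ≡⟨ ζ^-cong (≡⇒≡ₚ (ℕ.*-zeroʳ u')) x ⟩
    ζ^ 0 x                ≡⟨ 1ζ≐δ0 x ⟨
    1ζ x                  ∎
    where
    open ≡-Reasoning
    u' = proj₁ (inverseₚ u≢0)
    u'u≡1 = proj₂ (inverseₚ u≢0)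

  dilate-isRingHomomorphism : ∀ {u} → ¬ u ≡ₚ 0 →
                              IsRingHomomorphism (CommutativeRing.rawRing ℤ[Cₚ]) (CommutativeRing.rawRing ℤ[Cₚ]) (dilate u)
  dilate-isRingHomomorphism u≢0 = record
    { isSemiringHomomorphism = record
      { isNearSemiringHomomorphism = record
        { +-isMonoidHomomorphism = record
          { isMagmaHomomorphism = record
            { isRelHomomorphism = record { cong = λ f≐g x → f≐g _ }
            ; homo = λ f g x → refl }
          ; ε-homo = λ x → refl }
        ; *-homo = dilate-* u≢0 }
      ; 1#-homo = dilate-1 u≢0 }
    ; -‿homo = λ f x → refl }

module HalfSystem (p : ℕ) .{{_ : NonZero p}} (prime : Prime p) (2<p : 2 ℕ.< p) where
  open ℕ-Solver using (solve-∀)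
  open Mod p
  open ModPrime p prime
  open QuadraticResidues p prime 2<p using (p≡2r+1)

  r : ℕ
  r = rOf {p}

  r<p : r < p
  r<p = subst (r <_) (sym p≡2r+1) (ℕ.s≤s (ℕ.m≤m+n r r))

  rep : ℕ → ℕ
  rep a with a ℕ.% p ℕ.≤? r
  ... | yes _ = a ℕ.% p
  ... | no _ = p ∸ a ℕ.% p

  rep-≤ : ∀ a → rep a ≤ r
  rep-≤ a with a ℕ.% p ℕ.≤? r
  ... | yes a≤r = a≤r
  ... | no a≰r = ℕ.≤-trans (ℕ.∸-monoʳ-≤ p (ℕ.≰⇒> a≰r))
                           (ℕ.≤-reflexive (trans (cong (_∸ suc r) p≡2r+1) (ℕ.m+n∸m≡n r r)))

  rep-square : ∀ a → rep a ℕ.* rep a ≡ₚ a ℕ.* a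
  rep-square a with a ℕ.% p ℕ.≤? r
  ... | yes _ = *-congₚ (m%p≡ₚm a) (m%p≡ₚm a)
  ... | no _ = opposite-squares (p ∸ a ℕ.% p) a
    (≡ₚ-trans (+-congˡₚ (p ∸ a ℕ.% p) (≡ₚ-sym (m%p≡ₚm a))) (≡ₚ-trans (≡⇒≡ₚ (ℕ.m∸n+n≡m (m%n≤n a p))) p≡ₚ0))

  rep-unique : ∀ {x y} → x ≤ r → y ≤ r → x ℕ.* x ≡ₚ y ℕ.* y → x ≡ y
  rep-unique {x} {y} x≤r y≤r x²≡y² with square-rootsₚ x²≡y²
  ... | inj₁ (mod-≡ x≡y) =
    trans (sym (m<n⇒m%n≡m (ℕ.≤-<-trans x≤r r<p))) (trans x≡y (m<n⇒m%n≡m (ℕ.≤-<-trans y≤r r<p)))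
  ... | inj₂ (mod-≡ x+y≡0) = trans (ℕ.m+n≡0⇒m≡0 x x+y≡0′) (sym (ℕ.m+n≡0⇒n≡0 x x+y≡0′))
    where
    x+y<p : x ℕ.+ y < p
    x+y<p = subst (x ℕ.+ y <_) (sym p≡2r+1) (ℕ.s≤s (ℕ.+-mono-≤ x≤r y≤r))
    x+y≡0′ : x ℕ.+ y ≡ 0
    x+y≡0′ = trans (sym (m<n⇒m%n≡m x+y<p)) (trans x+y≡0 0%p≡0)

  half : ℕ → Fin (suc r)
  half a = fromℕ< (ℕ.s≤s (rep-≤ a))

  toℕ-half : ∀ a → toℕ (half a) ≡ rep a
  toℕ-half a = toℕ-fromℕ< (ℕ.s≤s (rep-≤ a))

  half-cancel : ∀ t t' → t' ℕ.* t ≡ₚ 1 → ∀ j → half (t ℕ.* toℕ (half (t' ℕ.* toℕ j))) ≡ j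
  half-cancel t t' t't≡1 j = toℕ-injective (trans (toℕ-half _) (rep-unique (rep-≤ _) (ℕ.≤-pred (toℕ<n j)) (begin
    rep w ℕ.* rep w
      ≈⟨ rep-square w ⟩
    w ℕ.* w
      ≡⟨ interchange t (toℕ (half (t' ℕ.* toℕ j))) ⟩
    t ℕ.* t ℕ.* (toℕ (half _) ℕ.* toℕ (half _))
      ≡⟨ cong (λ v → t ℕ.* t ℕ.* (v ℕ.* v)) (toℕ-half (t' ℕ.* toℕ j)) ⟩
    t ℕ.* t ℕ.* (rep (t' ℕ.* toℕ j) ℕ.* rep (t' ℕ.* toℕ j))
      ≈⟨ *-congˡₚ (t ℕ.* t) (rep-square (t' ℕ.* toℕ j)) ⟩
    t ℕ.* t ℕ.* (t' ℕ.* toℕ j ℕ.* (t' ℕ.* toℕ j))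
      ≡⟨ regroup t t' (toℕ j) ⟩
    t' ℕ.* t ℕ.* (t' ℕ.* t) ℕ.* (toℕ j ℕ.* toℕ j)
      ≈⟨ *-congʳₚ (toℕ j ℕ.* toℕ j) (*-congₚ t't≡1 t't≡1) ⟩
    1 ℕ.* 1 ℕ.* (toℕ j ℕ.* toℕ j)
      ≡⟨ ℕ.*-identityˡ _ ⟩
    toℕ j ℕ.* toℕ j ∎)))
    where
    open ≡ₚ-Reasoning
    w = t ℕ.* toℕ (half (t' ℕ.* toℕ j))
    interchange : ∀ t v → t ℕ.* v ℕ.* (t ℕ.* v) ≡ t ℕ.* t ℕ.* (v ℕ.* v)
    interchange = solve-∀
    regroup : ∀ t t' j → t ℕ.* t ℕ.* (t' ℕ.* j ℕ.* (t' ℕ.* j)) ≡ t' ℕ.* t ℕ.* (t' ℕ.* t) ℕ.* (j ℕ.* j)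
    regroup = solve-∀

  half-permutation : ∀ t t' → t' ℕ.* t ≡ₚ 1 → Permutation (suc r) (suc r)
  half-permutation t t' t't≡1 =
    permutation (λ j → half (t' ℕ.* toℕ j)) (λ j → half (t ℕ.* toℕ j)) (half-cancel t' t tt'≡1) (half-cancel t t' t't≡1)
    where
    tt'≡1 : t ℕ.* t' ≡ₚ 1
    tt'≡1 = ≡ₚ-trans (≡⇒≡ₚ (ℕ.*-comm t t')) t't≡1

module Invariance (p : ℕ) .{{_ : NonZero p}} (prime : Prime p) (2<p : 2 ℕ.< p) where
  open import Data.Integer using (_+_; _*_; _-_)
  open ℕ-Solver using (solve-∀)
  open Mod p
  open ModPrime p prime
  open IntegerSums
  open GroupRing p
  open QuadraticResidues p prime 2<p
  open GaussSum p prime 2<p using (ω)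
  open Dilation p prime
  open HalfSystem p prime 2<p
  open RootPolynomial ℤ[Cₚ]

  dilate-θ : ∀ c t t' → t' ℕ.* t ≡ₚ 1 → ∀ j → dilate (t ℕ.* t) (θ c j) ≐ θ c (half (t' ℕ.* toℕ j))
  dilate-θ c t t' t't≡1 j x =
    trans (dilate-ζ^ (t ℕ.* t) (t' ℕ.* t') t'²t²≡1 (c ℕ.* toℕ j ℕ.* toℕ j) x) (ζ^-cong exponents x)
    where
    open ≡ₚ-Reasoning
    interchange : ∀ a b → a ℕ.* a ℕ.* (b ℕ.* b) ≡ a ℕ.* b ℕ.* (a ℕ.* b)
    interchange = solve-∀
    t'²t²≡1 : t' ℕ.* t' ℕ.* (t ℕ.* t) ≡ₚ 1
    t'²t²≡1 = ≡ₚ-trans (≡⇒≡ₚ (interchange t' t)) (*-congₚ t't≡1 t't≡1)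
    regroup : ∀ s c j → s ℕ.* s ℕ.* (c ℕ.* j ℕ.* j) ≡ c ℕ.* ((s ℕ.* j) ℕ.* (s ℕ.* j))
    regroup = solve-∀
    h = half (t' ℕ.* toℕ j)
    exponents : t' ℕ.* t' ℕ.* (c ℕ.* toℕ j ℕ.* toℕ j) ≡ₚ c ℕ.* toℕ h ℕ.* toℕ h
    exponents = begin
      t' ℕ.* t' ℕ.* (c ℕ.* toℕ j ℕ.* toℕ j)
        ≡⟨ regroup t' c (toℕ j) ⟩
      c ℕ.* ((t' ℕ.* toℕ j) ℕ.* (t' ℕ.* toℕ j))
        ≈⟨ *-congˡₚ c (rep-square (t' ℕ.* toℕ j)) ⟨
      c ℕ.* (rep (t' ℕ.* toℕ j) ℕ.* rep (t' ℕ.* toℕ j))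
        ≡⟨ cong (λ v → c ℕ.* (v ℕ.* v)) (toℕ-half (t' ℕ.* toℕ j)) ⟨
      c ℕ.* (toℕ h ℕ.* toℕ h)
        ≡⟨ ℕ.*-assoc c (toℕ h) (toℕ h) ⟨
      c ℕ.* toℕ h ℕ.* toℕ h ∎

  SquareInvariant : R → Set
  SquareInvariant f = ∀ {t} → ¬ t ≡ₚ 0 → dilate (t ℕ.* t) f ≐ f

  ∏ᶠ-θ-squareInvariant : ∀ c k → SquareInvariant (∏ᶠ[x- θ c ] k)
  ∏ᶠ-θ-squareInvariant c k {t} t≢0 x = begin
    dilate (t ℕ.* t) (∏ᶠ[x- θ c ] k) x  ≡⟨ ∏ᶠ-homomorphic (dilate-isRingHomomorphism t²≢0) (θ c) k x ⟩
    ∏ᶠ[x- dilate (t ℕ.* t) ∘ θ c ] k x  ≡⟨ ∏ᶠ-cong (dilate-θ c t t' t't≡1) k x ⟩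
    ∏ᶠ[x- θ c ∘ (π ⟨$⟩ʳ_) ] k x         ≡⟨ ∏ᶠ-permute (θ c) π k x ⟩
    ∏ᶠ[x- θ c ] k x                     ∎
    where
    open ≡-Reasoning
    t' = proj₁ (inverseₚ t≢0)
    t't≡1 = proj₂ (inverseₚ t≢0)
    t²≢0 = *-nonzeroₚ t≢0 t≢0
    π = half-permutation t t' t't≡1

  invariant-at : ∀ {f} → SquareInvariant f → ∀ {t} → ¬ t ≡ₚ 0 →
                 ∀ x y → t ℕ.* t ℕ.* toℕ x ≡ₚ toℕ y → f y ≡ f x
  invariant-at {f} f-inv t≢0 x y e = trans (cong f (≡ₚ⇒≡[] (≡ₚ-sym e))) (f-inv t≢0 x)

  module _ {f} (f-inv : SquareInvariant f) where

    invariant-on-squares : ∀ x → ¬ toℕ x ≡ₚ 0 → IsSquare (toℕ x) → f x ≡ f [ 1 ]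
    invariant-on-squares x x≢0 (y , y²≡x) = invariant-at f-inv (root-nonzero (toℕ y) x≢0 y²≡x) [ 1 ] x
      (≡ₚ-trans (*-congˡₚ (y ²) (toℕ-[] 1)) (≡ₚ-trans (≡⇒≡ₚ (ℕ.*-identityʳ _)) y²≡x))

    invariant-on-nonsquares : ∀ n → ¬ IsSquare (toℕ n) → ∀ x → ¬ toℕ x ≡ₚ 0 → ¬ IsSquare (toℕ x) → f x ≡ f n
    invariant-on-nonsquares n n-nonsquare x x≢0 x-nonsquare =
      trans (sym (invariant-at f-inv n≢0 x z (≡ₚ-sym (toℕ-[] _))))
            (invariant-at f-inv (root-nonzero (toℕ b) (*-nonzeroₚ n≢0 x≢0) b²≡nx) n z b²n≡n²x)
      where
      n≢0 = nonsquare-nonzero n-nonsquare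
      nx-square = nonsquare-*-nonsquare n-nonsquare x x≢0 x-nonsquare
      b = proj₁ nx-square
      b²≡nx = proj₂ nx-square
      z = [ n ² ℕ.* toℕ x ]
      rotate : ∀ n x → n ℕ.* x ℕ.* n ≡ n ℕ.* n ℕ.* x
      rotate = solve-∀
      b²n≡n²x : b ² ℕ.* toℕ n ≡ₚ toℕ z
      b²n≡n²x = ≡ₚ-trans (*-congʳₚ (toℕ n) b²≡nx)
                         (≡ₚ-trans (≡⇒≡ₚ (rotate (toℕ n) (toℕ x))) (≡ₚ-sym (toℕ-[] _)))

    squareInvariant⇒ℤ[ω] : ∀ n → ¬ IsSquare (toℕ n) →
                           f ≈ζ fromℤζ (f [ 0 ] - f [ 1 ]) +ζ ((f [ 1 ] - f n) ·ζ ω)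
    squareInvariant⇒ℤ[ω] n n-nonsquare i j = trans (difference i) (sym (difference j))
      where
      open ≡-Reasoning
      A = f [ 0 ] - f [ 1 ]
      B = f [ 1 ] - f n
      at-zero : ∀ a b c → a - ((a - b) * + 1 + (b - c) * + 1) ≡ c
      at-zero = ℤ-Solver.solve-∀
      at-square : ∀ a b c → b - ((a - b) * + 0 + (b - c) * + 1) ≡ c
      at-square = ℤ-Solver.solve-∀
      at-nonsquare : ∀ a b c → c - (a * + 0 + b * + 0) ≡ c
      at-nonsquare = ℤ-Solver.solve-∀
      difference : ∀ x → f x - (fromℤζ A x + B * ω x) ≡ f n
      difference x with toℕ x ≟ₚ 0 | isSquare? (toℕ x)
      ... | yes x≡0 | no x-nonsquare = ⊥-elim (x-nonsquare (zero-isSquare x≡0))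
      ... | yes x≡0 | yes _ = begin
        f x - (fromℤζ A x + B * + 1)
          ≡⟨ cong₂ (λ a d → f a - (d + B * + 1)) (≡ₚ⇒≡[] x≡0) (trans (fromℤζ-apply A x) (cong (A *_) (δ0-≡ x≡0))) ⟩
        f [ 0 ] - (A * + 1 + B * + 1)
          ≡⟨ at-zero (f [ 0 ]) (f [ 1 ]) (f n) ⟩
        f n ∎
      ... | no x≢0 | yes x-square = begin
        f x - (fromℤζ A x + B * + 1)
          ≡⟨ cong₂ (λ a d → a - (d + B * + 1)) (invariant-on-squares x x≢0 x-square)
                                               (trans (fromℤζ-apply A x) (cong (A *_) (δ0-≢ x≢0))) ⟩
        f [ 1 ] - (A * + 0 + B * + 1)
          ≡⟨ at-square (f [ 0 ]) (f [ 1 ]) (f n) ⟩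
        f n ∎
      ... | no x≢0 | no x-nonsquare = begin
        f x - (fromℤζ A x + B * + 0)
          ≡⟨ cong₂ (λ a d → a - (d + B * + 0)) (invariant-on-nonsquares n n-nonsquare x x≢0 x-nonsquare)
                                               (trans (fromℤζ-apply A x) (cong (A *_) (δ0-≢ x≢0))) ⟩
        f n - (A * + 0 + B * + 0)
          ≡⟨ at-nonsquare A B (f n) ⟩
        f n ∎

module CompanionMatrix (p : ℕ) .{{_ : NonZero p}} (prime : Prime p) (2<p : 2 ℕ.< p) (c : ℕ) where
  open import Data.Integer using (_+_; _*_; _-_; -_)
  open Mod p
  open IntegerSums using (δ)
  open GroupRing p
  open CyclotomicIntegers p
  open QuadraticResidues p prime 2<p
  open GaussSum p prime 2<p using (ω)
  open Invariance p prime 2<p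
  open RootPolynomial ℤ[Cₚ]

  r : ℕ
  r = rOf {p}

  coefficient : Fin (suc r) → R
  coefficient l = -ζ ∏ᶠ[x- θ c ] (toℕ l)

  n₀ : Fin p
  n₀ = proj₁ nonresidue

  A B : Fin (suc r) → ℤ
  A l = coefficient l [ 0 ] - coefficient l [ 1 ]
  B l = coefficient l [ 1 ] - coefficient l n₀

  coefficient∈ℤ[ω] : ∀ l → coefficient l ≈ζ fromℤζ (A l) +ζ (B l ·ζ ω)
  coefficient∈ℤ[ω] l =
    squareInvariant⇒ℤ[ω] (λ t≢0 x → cong -_ (∏ᶠ-θ-squareInvariant c (toℕ l) t≢0 x)) n₀ (proj₂ nonresidue)

  column-a column-b : (k : Fin (suc r)) → Dec (toℕ k < r) → Fin (suc r) → ℤ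
  column-a k (yes k<r) = δ (fromℕ< (s≤s k<r))
  column-a k (no _) = A
  column-b k (yes _) _ = + 0
  column-b k (no _) = B

  a b : Fin (suc r) → Fin (suc r) → ℤ
  a l k = column-a k (toℕ k ℕ.<? r) l
  b l k = column-b k (toℕ k ℕ.<? r) l

  sumζ≡sum : ∀ {n} (F : Fin n → R) → sumζ F ≡ sum F
  sumζ≡sum {zero} F = refl
  sumζ≡sum {suc n} F = cong (F Fin.zero +ζ_) (sumζ≡sum (F ∘ Fin.suc))

  ^ζ≡^ : ∀ f n → f ^ζ n ≡ f ^ n
  ^ζ≡^ f zero = refl
  ^ζ≡^ f (suc n) = cong (f *ζ_) (^ζ≡^ f n)

  V⊗coefficients : ∀ j → sumζ (λ l → Vmat c j l *ζ coefficient l) ≐ θ c j ^ζ suc r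
  V⊗coefficients j i = begin
    sumζ (λ l → Vmat c j l *ζ coefficient l) i
      ≡⟨ cong (λ s → s i) (sumζ≡sum (λ l → Vmat c j l *ζ coefficient l)) ⟩
    sumTo (suc r) (λ n → (θ c j ^ζ n) *ζ -ζ ∏ᶠ[x- θ c ] n) i
      ≡⟨ sumTo-cong (suc r) (λ n i′ → cong (λ f → (f *ζ -ζ ∏ᶠ[x- θ c ] n) i′) (^ζ≡^ (θ c j) n)) i ⟩
    sumTo (suc r) (λ n → (θ c j ^ n) *ζ -ζ ∏ᶠ[x- θ c ] n) i
      ≡⟨ ∏ᶠ-companion (θ c) j i ⟩
    (θ c j ^ suc r) i
      ≡⟨ cong (λ f → f i) (^ζ≡^ (θ c j) (suc r)) ⟨
    (θ c j ^ζ suc r) i ∎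
    where open ≡-Reasoning

  V⊗column≈ : ∀ j k (d : Dec (toℕ k < r)) →
              sumζ (λ l → Vmat c j l *ζ (fromℤζ (column-a k d l) +ζ (column-b k d l ·ζ ω))) ≈ζ θ c j ^ζ suc (toℕ k)
  V⊗column≈ j k (yes k<r) = ≐⇒≈ζ λ i → begin
    sumζ (λ l → V l *ζ (fromℤζ (δ k+1 l) +ζ (+ 0 ·ζ ω))) i
      ≡⟨ sumζ-apply (λ l → V l *ζ (fromℤζ (δ k+1 l) +ζ (+ 0 ·ζ ω))) i ⟩
    IntegerSums.sum (λ l → (V l *ζ (fromℤζ (δ k+1 l) +ζ (+ 0 ·ζ ω))) i)
      ≡⟨ IntegerSums.sum-cong-≗ (λ l → term l i) ⟩
    IntegerSums.sum (λ l → δ k+1 l * V l i)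
      ≡⟨ IntegerSums.sum-δ k+1 (λ l → V l i) ⟩
    V k+1 i
      ≡⟨ cong (λ n → (θ c j ^ζ n) i) (toℕ-fromℕ< (s≤s k<r)) ⟩
    (θ c j ^ζ suc (toℕ k)) i ∎
    where
    open ≡-Reasoning
    k+1 = fromℕ< (s≤s k<r)
    V = Vmat c j
    term : ∀ l → (V l *ζ (fromℤζ (δ k+1 l) +ζ (+ 0 ·ζ ω))) ≐ (δ k+1 l ·ζ V l)
    term l i = begin
      (V l *ζ (fromℤζ (δ k+1 l) +ζ (+ 0 ·ζ ω))) i
        ≡⟨ *ζ-congˡ (V l) no-ω-part i ⟩
      (V l *ζ fromℤζ (δ k+1 l)) i
        ≡⟨ *ζ-comm (V l) (fromℤζ (δ k+1 l)) i ⟩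
      (fromℤζ (δ k+1 l) *ζ V l) i
        ≡⟨ fromℤζ-*ζ (δ k+1 l) (V l) i ⟩
      δ k+1 l * V l i ∎
      where
      no-ω-part : fromℤζ (δ k+1 l) +ζ (+ 0 ·ζ ω) ≐ fromℤζ (δ k+1 l)
      no-ω-part i′ = trans (cong (_+_ (fromℤζ (δ k+1 l) i′)) (ℤ.*-zeroˡ (ω i′))) (ℤ.+-identityʳ (fromℤζ (δ k+1 l) i′))
  V⊗column≈ j k (no k≮r) =
    ≈ζ-trans {sumζ (λ l → V l *ζ (fromℤζ (A l) +ζ (B l ·ζ ω)))} {sumζ (λ l → V l *ζ coefficient l)}
      (sumζ-cong≈ {F = λ l → V l *ζ (fromℤζ (A l) +ζ (B l ·ζ ω))} {G = λ l → V l *ζ coefficient l} entry≈)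
      (≐⇒≈ζ (λ i → trans (V⊗coefficients j i) (cong (λ n → (θ c j ^ζ suc n) i) (sym k≡r))))
    where
    V = Vmat c j
    entry≈ : ∀ l → V l *ζ (fromℤζ (A l) +ζ (B l ·ζ ω)) ≈ζ V l *ζ coefficient l
    entry≈ l = *ζ-cong≈ {V l} {V l} {fromℤζ (A l) +ζ (B l ·ζ ω)} {coefficient l}
                 (≐⇒≈ζ {V l} (λ _ → refl)) (≈ζ-sym {coefficient l} (coefficient∈ℤ[ω] l))
    k≡r : toℕ k ≡ r
    k≡r = ℕ.≤-antisym (ℕ.≤-pred (toℕ<n k)) (ℕ.≮⇒≥ k≮r)

  V⊗C≈T⊗V : (Vmat c ⊗ (λ l k → fromℤζ (a l k) +ζ (b l k ·ζ ω))) ≈M (Tmat c ⊗ Vmat c)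
  V⊗C≈T⊗V j k = ≈ζ-trans {(Vmat c ⊗ (λ l k → fromℤζ (a l k) +ζ (b l k ·ζ ω))) j k} {θ c j ^ζ suc (toℕ k)}
    (V⊗column≈ j k (toℕ k ℕ.<? r)) (≐⇒≈ζ (λ i → sym (diagonal-⊗ (θ c) (Vmat c) j k i)))

theorem4p1 : (p : ℕ) .{{_ : NonZero p}} → Prime p → 2 < p →
    (c : ℕ) → (c ≡ 1 ⊎ NonResidue p c) →
    Σ (Zζ p) (λ ω →
      ((((+ 2) ·ζ ω) -ζ 1ζ) *ζ (((+ 2) ·ζ ω) -ζ 1ζ)) ≈ζ fromℤζ (εp {p})
      × Σ (Fin (suc (rOf {p})) → Fin (suc (rOf {p})) → ℤ) (λ a →
          Σ (Fin (suc (rOf {p})) → Fin (suc (rOf {p})) → ℤ) (λ b →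
            (Vmat c ⊗ (λ j k → fromℤζ (a j k) +ζ (b j k ·ζ ω)))
              ≈M (Tmat c ⊗ Vmat c))))
theorem4p1 p p-prime 2<p c _ = ω , [2ω-1]²≈εp , a , b , V⊗C≈T⊗V
  where
  open GroupRing p
  open CyclotomicIntegers p
  open GaussSum p p-prime 2<p
  open CompanionMatrix p p-prime 2<p c
  [2ω-1]²≈εp : (((+ 2) ·ζ ω) -ζ 1ζ) *ζ (((+ 2) ·ζ ω) -ζ 1ζ) ≈ζ fromℤζ (εp {p})
  [2ω-1]²≈εp = ≈ζ-trans {(((+ 2) ·ζ ω) -ζ 1ζ) *ζ (((+ 2) ·ζ ω) -ζ 1ζ)} {gauss *ζ gauss}
                 (≐⇒≈ζ (*ζ-cong 2ω-1≐gauss 2ω-1≐gauss)) gauss²≈εp
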